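{- Let $\varepsilon$ be a unit of a number field $K$ with minimal polynomial $F\in\mathbb{Z}[x]$ over $\mathbb{Q}$, and let $\phi:\mathbb{Z}[x]\to\mathbb{F}_2[x]$ be reduction modulo $2$. If $n$ is the degree of an irreducible factor of $\phi(F)$ over $\mathbb{F}_2$, then $\varepsilon^{2^n-1}$ is even.
   Context: For an integer polynomial $g(x)=b_mx^m+\dots+b_0$, its length is $L(g)=|b_m|+\dots+|b_0|$. An algebraic integer $\alpha$ is called even if $L(f)$ is even, where $f$ is the minimal monic polynomial of $\alpha$ over $\mathbb{Q}$, and odd otherwise. -}

module Defs where

open import Level using (_⊔_)
open import Data.Nat as ℕ using (ℕ; zero; suc; _∸_; _%_; _≡ᵇ_)
open import Data.Nat.Divisibility using (_∣_)
open import Data.Integer as ℤ using (ℤ; +_; -[1+_]; ∣_∣)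
import Data.Integer.Properties as ℤP
open import Data.Rational as ℚ using (ℚ; 0ℚ; 1ℚ; _/_)
import Data.Rational.Properties as ℚP
open import Data.Bool using (Bool; true; false; _xor_; _∧_)
import Data.Bool.Properties as BoolP
open import Data.List using (List; []; _∷_; map; length)
open import Data.Nat.ListAction using (sum)
open import Data.Product using (Σ; ∃; _×_; _,_)
open import Data.Sum using (_⊎_)
open import Relation.Nullary using (¬_; yes; no)
open import Relation.Binary.PropositionalEquality using (_≡_)
open import Relation.Binary.Definitions using (DecidableEquality)
open import Algebra.Bundles using (CommutativeRing)

-- Univariate polynomials over a commutative coefficient type A with
-- decidable (propositional) equality, as coefficient lists
-- [a₀, a₁, …, aₘ] (lowest degree first).  Lists differing only by
-- trailing zeros represent the same polynomial (see _≈ₚ_).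

module PolyOver {A : Set} (0a 1a : A) (_+a_ _*a_ : A → A → A)
                (_≟a_ : DecidableEquality A) where

  Poly : Set
  Poly = List A

  coeff : Poly → ℕ → A
  coeff []      _       = 0a
  coeff (a ∷ p) zero    = a
  coeff (a ∷ p) (suc i) = coeff p i

  _≈ₚ_ : Poly → Poly → Set
  p ≈ₚ q = ∀ i → coeff p i ≡ coeff q i

  _⊕_ : Poly → Poly → Poly
  []      ⊕ q       = q
  (a ∷ p) ⊕ []      = a ∷ p
  (a ∷ p) ⊕ (b ∷ q) = (a +a b) ∷ (p ⊕ q)

  scale : A → Poly → Poly
  scale a = map (a *a_)

  _⊛_ : Poly → Poly → Poly
  []      ⊛ q = []
  (a ∷ p) ⊛ q = scale a q ⊕ (0a ∷ (p ⊛ q))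

  strip : Poly → Poly
  strip [] = []
  strip (a ∷ p) with strip p
  ... | b ∷ q = a ∷ b ∷ q
  ... | [] with a ≟a 0a
  ...   | yes _ = []
  ...   | no  _ = a ∷ []

  -- degree (the zero polynomial gets degree 0 by convention)
  deg : Poly → ℕ
  deg p = length (strip p) ∸ 1

  lastA : List A → A
  lastA []          = 0a
  lastA (a ∷ [])    = a
  lastA (a ∷ b ∷ q) = lastA (b ∷ q)

  lead : Poly → A
  lead p = lastA (strip p)

  Monic : Poly → Set
  Monic p = lead p ≡ 1a

  _∣ₚ_ : Poly → Poly → Set
  p ∣ₚ q = ∃ λ r → (p ⊛ r) ≈ₚ q

  Irreducible : Poly → Set
  Irreducible p = (1 ℕ.≤ deg p) ×
    (∀ g h → (g ⊛ h) ≈ₚ p → deg g ≡ 0 ⊎ deg h ≡ 0)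

module ℤX = PolyOver (+ 0) (+ 1) ℤ._+_ ℤ._*_ ℤ._≟_
module ℚX = PolyOver 0ℚ 1ℚ ℚ._+_ ℚ._*_ ℚP._≟_
module 𝔽₂X = PolyOver false true _xor_ _∧_ BoolP._≟_

toℚ : ℤ → ℚ
toℚ z = z / 1

red₂ : ℤ → Bool
red₂ z = (∣ z ∣ % 2) ≡ᵇ 1

φ : ℤX.Poly → 𝔽₂X.Poly
φ = map red₂

IrreducibleOverℚ : ℤX.Poly → Set
IrreducibleOverℚ f = ℚX.Irreducible (map toℚ f)

L : ℤX.Poly → ℕ
L g = sum (map ∣_∣ g)

module InRing {c ℓ} (K : CommutativeRing c ℓ) where
  open CommutativeRing K

  natK : ℕ → Carrier
  natK zero    = 0#
  natK (suc n) = 1# + natK n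

  intK : ℤ → Carrier
  intK (+ n)      = natK n
  intK -[1+ n ]   = - natK (suc n)

  powK : Carrier → ℕ → Carrier
  powK x zero    = 1#
  powK x (suc k) = x * powK x k

  eval : ℤX.Poly → Carrier → Carrier
  eval []      x = 0#
  eval (a ∷ p) x = intK a + x * eval p x

  IsFieldChar0 : Set (c ⊔ ℓ)
  IsFieldChar0 = (¬ (1# ≈ 0#))
    × (∀ x → ¬ (x ≈ 0#) → ∃ λ y → (x * y) ≈ 1#)
    × (∀ n → natK n ≈ 0# → n ≡ 0)

  IsMinPoly : ℤX.Poly → Carrier → Set ℓ
  IsMinPoly F x = ℤX.Monic F × IrreducibleOverℚ F × (eval F x ≈ 0#)

  IsAlgInt : Carrier → Set ℓ
  IsAlgInt x = ∃ λ H → ℤX.Monic H × (eval H x ≈ 0#)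

  -- unit of the ring of integers
  IsUnit : Carrier → Set (c ⊔ ℓ)
  IsUnit x = IsAlgInt x × (∃ λ y → ((x * y) ≈ 1#) × IsAlgInt y)

  IsEven : Carrier → Set ℓ
  IsEven x = ∀ G → IsMinPoly G x → 2 ∣ L G

{-# OPTIONS --safe #-}

-- Let m = 2ⁿ − 1 and let G be the minimal polynomial of εᵐ. The integer polynomial G(Xᵐ)
-- vanishes at ε, so the monic polynomial F, being irreducible over ℚ, divides it in ℤ[X];
-- reducing modulo 2, P divides φ(G)(Xᵐ). As ε is a unit, some integer polynomial with
-- constant term 1 vanishes at ε, so P does not divide X. In the field 𝔽₂[X]/P, which has
-- 2ⁿ − 1 nonzero elements, multiplication by X permutes them, so Xᵐ ≡ 1 (mod P). Hence P
-- divides the constant φ(G)(1), which is therefore 0; and φ(G)(1) is L(G) modulo 2.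

module Submission where

open import Defs
open import Data.Nat using (ℕ; _∸_; _^_)
open import Algebra.Bundles using (CommutativeRing)
open import Relation.Binary.PropositionalEquality using (_≡_)

open import Level using (0ℓ; _⊔_)
open import Data.Nat as ℕ using (zero; suc; _≤_; _<_; z≤n; s≤s; _%_; _≡ᵇ_)
import Data.Nat.Properties as ℕP
open import Data.Nat.DivMod using ([m+n]%n≡m%n)
open import Data.Nat.Divisibility using (divides) renaming (_∣_ to _∣ℕ_)
open import Data.Nat.Coprimality as Coprimality using (Coprime)
open import Data.Integer as ℤ using (ℤ)
import Data.Integer.Properties as ℤP
open import Data.Rational as ℚ using (ℚ; 0ℚ; 1ℚ; mkℚ)
import Data.Rational.Properties as ℚP
open import Data.Bool using (Bool; true; false; _xor_; _∧_; not)
import Data.Bool.Properties as BoolP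
open import Data.Maybe using (Maybe; just; nothing)
open import Data.List using (List; []; _∷_; _∷ʳ_; _++_; map; length; foldr; reverse)
import Data.List.Properties as ListP
open import Data.List.Membership.Propositional using (_∈_)
open import Data.List.Membership.Propositional.Properties
  using (∈-map⁺; ∈-map⁻; ∈-++⁺ˡ; ∈-++⁺ʳ; ∈-++⁻; ∈-∃++)
open import Data.List.Relation.Unary.Any using (here; there)
import Data.List.Relation.Unary.All as All
import Data.List.Relation.Unary.AllPairs as AllPairs
open import Data.List.Relation.Unary.Unique.Propositional using (Unique)
import Data.List.Relation.Unary.Unique.Propositional.Properties as Unique
open import Data.List.Relation.Binary.Permutation.Propositional
  using (_↭_; prep; ↭-refl; ↭-sym; ↭-trans; ↭⇒↭ₛ′)
open import Data.List.Relation.Binary.Permutation.Propositional.Properties using () renaming (shift to ↭-shift)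
import Data.List.Relation.Binary.Permutation.Setoid.Properties as SetoidPermutation
open import Data.Product using (Σ; _×_; _,_; proj₁; proj₂)
open import Data.Sum using (_⊎_; inj₁; inj₂; [_,_]′)
open import Data.Empty using (⊥; ⊥-elim)
open import Function using (id; _∘_; case_of_)
open import Relation.Nullary using (¬_; yes; no)
open import Relation.Binary.PropositionalEquality as ≡ using (_≢_)
open import Relation.Binary.Definitions using (DecidableEquality; tri<; tri≈; tri>)
open import Relation.Binary.Bundles using (Setoid)
open import Relation.Binary.Structures using (IsEquivalence)
open import Algebra.Bundles using (Semiring)
open import Algebra.Structures using (IsCommutativeRing)
import Algebra.Properties.Ring as RingProperties
import Algebra.Properties.Semiring.Mult as SemiringMultiplication
import Algebra.Properties.CommutativeSemigroup as CommutativeSemigroupProperties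
open import Algebra.Solver.Ring.AlmostCommutativeRing using (_-Raw-AlmostCommutative⟶_; fromCommutativeRing)
import Algebra.Solver.Ring as RingSolver
import Relation.Binary.Reasoning.Setoid as SetoidReasoning

module IntegerEmbedding {c ℓ} (K : CommutativeRing c ℓ) where

  open CommutativeRing K
  open InRing K using (natK; intK)
  open import Data.Integer.Base using (+_; -[1+_]; _⊖_)
  open RingProperties ring using (-0#≈0#; -‿involutive; -‿distribˡ-*; -‿distribʳ-*; -‿+-comm)
  open SemiringMultiplication semiring using (×-homo-+; ×1-homo-*) renaming (_×_ to _×ᴷ_)
  open CommutativeSemigroupProperties +-commutativeSemigroup using (interchange)
  open SetoidReasoning setoid

  natK≡×1# : ∀ n → natK n ≡ n ×ᴷ 1#
  natK≡×1# zero    = ≡.refl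
  natK≡×1# (suc n) = ≡.cong (λ k → 1# + k) (natK≡×1# n)

  natK-+ : ∀ m n → natK (m ℕ.+ n) ≈ natK m + natK n
  natK-+ m n = begin
    natK (m ℕ.+ n)        ≡⟨ natK≡×1# (m ℕ.+ n) ⟩
    (m ℕ.+ n) ×ᴷ 1#        ≈⟨ ×-homo-+ 1# m n ⟩
    m ×ᴷ 1# + n ×ᴷ 1#       ≡⟨ ≡.cong₂ _+_ (natK≡×1# m) (natK≡×1# n) ⟨
    natK m + natK n       ∎

  natK-* : ∀ m n → natK (m ℕ.* n) ≈ natK m * natK n
  natK-* m n = begin
    natK (m ℕ.* n)        ≡⟨ natK≡×1# (m ℕ.* n) ⟩
    (m ℕ.* n) ×ᴷ 1#        ≈⟨ ×1-homo-* m n ⟩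
    (m ×ᴷ 1#) * (n ×ᴷ 1#)   ≡⟨ ≡.cong₂ _*_ (natK≡×1# m) (natK≡×1# n) ⟨
    natK m * natK n       ∎

  intK-neg : ∀ z → intK (ℤ.- z) ≈ - intK z
  intK-neg (+ zero)    = sym -0#≈0#
  intK-neg (+ suc n)   = refl
  intK-neg -[1+ n ]    = sym (-‿involutive _)

  intK-⊖ : ∀ m n → intK (m ⊖ n) ≈ natK m - natK n
  intK-⊖ m       zero    = begin
    intK (m ⊖ 0)          ≡⟨ ≡.cong intK (ℤP.⊖-≥ {m} ℕ.z≤n) ⟩
    natK m                ≈⟨ +-identityʳ _ ⟨
    natK m + 0#           ≈⟨ +-congˡ -0#≈0# ⟨
    natK m - 0#           ∎
  intK-⊖ zero    (suc n) = sym (+-identityˡ _)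
  intK-⊖ (suc m) (suc n) = begin
    intK (suc m ⊖ suc n)                ≡⟨ ≡.cong intK (ℤP.[1+m]⊖[1+n]≡m⊖n m n) ⟩
    intK (m ⊖ n)                        ≈⟨ intK-⊖ m n ⟩
    natK m - natK n                     ≈⟨ +-identityˡ _ ⟨
    0# + (natK m - natK n)              ≈⟨ +-congʳ (-‿inverseʳ 1#) ⟨
    (1# - 1#) + (natK m - natK n)       ≈⟨ interchange 1# (- 1#) (natK m) (- natK n) ⟩
    (1# + natK m) + (- 1# - natK n)     ≈⟨ +-congˡ (-‿+-comm 1# (natK n)) ⟩
    natK (suc m) - natK (suc n)         ∎

  intK-+ : ∀ a b → intK (a ℤ.+ b) ≈ intK a + intK b
  intK-+ (+ m)    (+ n)    = natK-+ m n
  intK-+ (+ m)    -[1+ n ] = intK-⊖ m (suc n)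
  intK-+ -[1+ m ] (+ n)    = trans (intK-⊖ n (suc m)) (+-comm _ _)
  intK-+ -[1+ m ] -[1+ n ] = begin
    - natK (suc (suc (m ℕ.+ n)))            ≡⟨ ≡.cong (λ k → - natK (suc k)) (ℕP.+-suc m n) ⟨
    - natK (suc m ℕ.+ suc n)                ≈⟨ -‿cong (natK-+ (suc m) (suc n)) ⟩
    - (natK (suc m) + natK (suc n))         ≈⟨ -‿+-comm _ _ ⟨
    - natK (suc m) - natK (suc n)           ∎

  private
    intK-*-+ : ∀ m b → intK (+ m ℤ.* b) ≈ natK m * intK b
    intK-*-+ m (+ n)    = begin
      intK (+ m ℤ.* + n)                    ≡⟨ ≡.cong intK (ℤP.pos-* m n) ⟨
      natK (m ℕ.* n)                        ≈⟨ natK-* m n ⟩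
      natK m * natK n                       ∎
    intK-*-+ m -[1+ n ] = begin
      intK (+ m ℤ.* -[1+ n ])               ≡⟨ ≡.cong intK (ℤP.neg-distribʳ-* (+ m) (+ suc n)) ⟨
      intK (ℤ.- (+ m ℤ.* + suc n))          ≈⟨ intK-neg (+ m ℤ.* + suc n) ⟩
      - intK (+ m ℤ.* + suc n)              ≈⟨ -‿cong (intK-*-+ m (+ suc n)) ⟩
      - (natK m * natK (suc n))             ≈⟨ -‿distribʳ-* (natK m) _ ⟩
      natK m * intK -[1+ n ]                ∎

  intK-* : ∀ a b → intK (a ℤ.* b) ≈ intK a * intK b
  intK-* (+ m)    b = intK-*-+ m b
  intK-* -[1+ m ] b = begin
    intK (-[1+ m ] ℤ.* b)                   ≡⟨ ≡.cong intK (ℤP.neg-distribˡ-* (+ suc m) b) ⟨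
    intK (ℤ.- (+ suc m ℤ.* b))              ≈⟨ intK-neg (+ suc m ℤ.* b) ⟩
    - intK (+ suc m ℤ.* b)                  ≈⟨ -‿cong (intK-*-+ (suc m) b) ⟩
    - (natK (suc m) * intK b)               ≈⟨ -‿distribˡ-* _ (intK b) ⟩
    intK -[1+ m ] * intK b                  ∎

  intK≈0⇒≡0 : (∀ n → natK n ≈ 0# → n ≡ 0) → ∀ {z} → intK z ≈ 0# → z ≡ ℤ.0ℤ
  intK≈0⇒≡0 char-0 {+ n}      n≈0  = ≡.cong +_ (char-0 n n≈0)
  intK≈0⇒≡0 char-0 { -[1+ n ]} -n≈0 = case char-0 (suc n) n≈0 of λ ()
    where
    n≈0 : natK (suc n) ≈ 0#
    n≈0 = begin
      natK (suc n)         ≈⟨ -‿involutive _ ⟨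
      - - natK (suc n)     ≈⟨ -‿cong -n≈0 ⟩
      - 0#                 ≈⟨ -0#≈0# ⟩
      0#                   ∎

  intK-morphism : ℤ.+-*-rawRing -Raw-AlmostCommutative⟶ fromCommutativeRing K
  intK-morphism = record
    { ⟦_⟧ = intK ; +-homo = intK-+ ; *-homo = intK-* ; -‿homo = intK-neg
    ; 0-homo = refl ; 1-homo = +-identityʳ 1# }

  intK-≟ : ∀ a b → Maybe (intK a ≈ intK b)
  intK-≟ a b with a ℤ.≟ b
  ... | yes ≡.refl = just refl
  ... | no _       = nothing

  -- Integer coefficients let the solver decide cancellations such as x - x ≈ 0#, which it
  -- cannot do with K's own elements as coefficients.
  module Solver = RingSolver ℤ.+-*-rawRing (fromCommutativeRing K) intK-morphism intK-≟

module Congruence {c ℓ} (R : CommutativeRing c ℓ) where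

  open CommutativeRing R
  open import Algebra.Properties.Semiring.Divisibility semiring public
    using (_∣_; _,_; _∣0; ∣ʳ-trans; x∣ʳyx; x∣ʳy⇒x∣ʳzy; ∣ʳ-respʳ-≈; ∣ʳ-respˡ-≈)
  open RingProperties ring using (-‿distribˡ-*)
  open IntegerEmbedding.Solver R using (solve; _:+_; _:-_; :-_; _:*_; _:=_)

  ∣-+ : ∀ {m x y} → m ∣ x → m ∣ y → m ∣ x + y
  ∣-+ {m} (p , pm≈x) (q , qm≈y) = p + q , trans (distribʳ m p q) (+-cong pm≈x qm≈y)

  ∣-neg : ∀ {m x} → m ∣ x → m ∣ - x
  ∣-neg {m} (p , pm≈x) = - p , trans (sym (-‿distribˡ-* p m)) (-‿cong pm≈x)

  infix 4 _≈_mod_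
  record _≈_mod_ (x y m : Carrier) : Set (c ⊔ ℓ) where
    constructor divides-difference
    field m∣x-y : m ∣ x - y
  open _≈_mod_ public

  ≈⇒≈mod : ∀ {x y m} → x ≈ y → x ≈ y mod m
  ≈⇒≈mod {x} {y} {m} x≈y = divides-difference (∣ʳ-respʳ-≈ 0≈x-y (m ∣0))
    where
    0≈x-y : 0# ≈ x - y
    0≈x-y = sym (trans (+-congˡ (-‿cong (sym x≈y))) (-‿inverseʳ x))

  mod-sym : ∀ {x y m} → x ≈ y mod m → y ≈ x mod m
  mod-sym {x} {y} (divides-difference m∣x-y) = divides-difference
    (∣ʳ-respʳ-≈ (solve 2 (λ x y → :- (x :- y) := y :- x) refl x y) (∣-neg m∣x-y))

  mod-trans : ∀ {x y z m} → x ≈ y mod m → y ≈ z mod m → x ≈ z mod m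
  mod-trans {x} {y} {z} (divides-difference m∣x-y) (divides-difference m∣y-z) = divides-difference
    (∣ʳ-respʳ-≈ (solve 3 (λ x y z → (x :- y) :+ (y :- z) := x :- z) refl x y z) (∣-+ m∣x-y m∣y-z))

  mod-+ : ∀ {x x′ y y′ m} → x ≈ x′ mod m → y ≈ y′ mod m → x + y ≈ x′ + y′ mod m
  mod-+ {x} {x′} {y} {y′} (divides-difference m∣x-x′) (divides-difference m∣y-y′) = divides-difference
    (∣ʳ-respʳ-≈ (solve 4 (λ x x′ y y′ → (x :- x′) :+ (y :- y′) := (x :+ y) :- (x′ :+ y′))
                      refl x x′ y y′)
             (∣-+ m∣x-x′ m∣y-y′))

  mod-* : ∀ {x x′ y y′ m} → x ≈ x′ mod m → y ≈ y′ mod m → x * y ≈ x′ * y′ mod m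
  mod-* {x} {x′} {y} {y′} (divides-difference m∣x-x′) (divides-difference m∣y-y′) = divides-difference
    (∣ʳ-respʳ-≈ (solve 4 (λ x x′ y y′ → y :* (x :- x′) :+ x′ :* (y :- y′) := x :* y :- x′ :* y′)
                      refl x x′ y y′)
             (∣-+ (x∣ʳy⇒x∣ʳzy y m∣x-x′) (x∣ʳy⇒x∣ʳzy x′ m∣y-y′)))

  ≈*+⇒≈mod : ∀ {x m q r} → x ≈ q * m + r → x ≈ r mod m
  ≈*+⇒≈mod {x} {m} {q} {r} x≈qm+r = divides-difference (q , (begin
    q * m                  ≈⟨ solve 3 (λ q m r → q :* m := (q :* m :+ r) :- r) refl q m r ⟩
    (q * m + r) - r        ≈⟨ +-congʳ x≈qm+r ⟨
    x - r                  ∎))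
    where open SetoidReasoning setoid

  ∣-resp-mod : ∀ {x y m} → x ≈ y mod m → m ∣ x → m ∣ y
  ∣-resp-mod {x} {y} (divides-difference m∣x-y) m∣x =
    ∣ʳ-respʳ-≈ (solve 2 (λ x y → x :- (x :- y) := y) refl x y) (∣-+ m∣x (∣-neg m∣x-y))

record CoefficientRing : Set₁ where
  infixl 6 _+_
  infixl 7 _*_
  infix  8 -_
  field
    Carrier           : Set
    0# 1#             : Carrier
    _+_ _*_           : Carrier → Carrier → Carrier
    -_                : Carrier → Carrier
    _≟_               : DecidableEquality Carrier
    isCommutativeRing : IsCommutativeRing _≡_ _+_ _*_ -_ 0# 1#

  commutativeRing : CommutativeRing 0ℓ 0ℓ
  commutativeRing = record { isCommutativeRing = isCommutativeRing }

module Polynomials (R : CoefficientRing) where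

  open CoefficientRing R using (_≟_) renaming (Carrier to A; 0# to 0a; 1# to 1a)
  open PolyOver 0a 1a (CoefficientRing._+_ R) (CoefficientRing._*_ R) _≟_ public

  private
    module C = CommutativeRing (CoefficientRing.commutativeRing R)
    module CP = RingProperties C.ring
    open C using (_+_; _*_; -_; _-_)
    open ≡ using (refl; sym; trans; cong; cong₂; subst)

  -- Defs' _≈ₚ_, as a record so that its indices can be inferred.
  infix 4 _≋_
  record _≋_ (p q : Poly) : Set where
    constructor coeffwise
    field at : ∀ i → coeff p i ≡ coeff q i
  open _≋_ public

  ≋-refl : ∀ {p} → p ≋ p
  ≋-refl = coeffwise (λ _ → refl)

  ≋-sym : ∀ {p q} → p ≋ q → q ≋ p
  ≋-sym e = coeffwise (λ i → sym (at e i))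

  ≋-trans : ∀ {p q r} → p ≋ q → q ≋ r → p ≋ r
  ≋-trans e f = coeffwise (λ i → trans (at e i) (at f i))

  ≋-reflexive : ∀ {p q} → p ≡ q → p ≋ q
  ≋-reflexive refl = ≋-refl

  ≋-isEquivalence : IsEquivalence _≋_
  ≋-isEquivalence = record { refl = ≋-refl ; sym = ≋-sym ; trans = ≋-trans }

  ≋-setoid : Setoid 0ℓ 0ℓ
  ≋-setoid = record { isEquivalence = ≋-isEquivalence }

  module ≋-Reasoning = SetoidReasoning ≋-setoid

  ∷-cong : ∀ {a b p q} → a ≡ b → p ≋ q → a ∷ p ≋ b ∷ q
  ∷-cong a≡b p≋q = coeffwise λ { zero → a≡b ; (suc i) → at p≋q i }

  ∷-injective : ∀ {a b p q} → a ∷ p ≋ b ∷ q → a ≡ b × p ≋ q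
  ∷-injective e = at e zero , coeffwise (λ i → at e (suc i))

  ∷≋[]⁻ : ∀ {a p} → a ∷ p ≋ [] → a ≡ 0a × p ≋ []
  ∷≋[]⁻ e = at e zero , coeffwise (λ i → at e (suc i))

  ∷≋[]⁺ : ∀ {a p} → a ≡ 0a → p ≋ [] → a ∷ p ≋ []
  ∷≋[]⁺ a≡0 p≋[] = coeffwise λ { zero → a≡0 ; (suc i) → at p≋[] i }

  shift : Poly → Poly
  shift p = 0a ∷ p

  shift-≋[] : ∀ {p} → p ≋ [] → shift p ≋ []
  shift-≋[] = ∷≋[]⁺ refl

  neg : Poly → Poly
  neg = map (λ a → - a)

  one : Poly
  one = 1a ∷ []

  coeff-⊕ : ∀ p q i → coeff (p ⊕ q) i ≡ coeff p i + coeff q i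
  coeff-⊕ []      q       i       = sym (C.+-identityˡ _)
  coeff-⊕ (a ∷ p) []      zero    = sym (C.+-identityʳ a)
  coeff-⊕ (a ∷ p) []      (suc i) = sym (C.+-identityʳ _)
  coeff-⊕ (a ∷ p) (b ∷ q) zero    = refl
  coeff-⊕ (a ∷ p) (b ∷ q) (suc i) = coeff-⊕ p q i

  coeff-scale : ∀ a p i → coeff (scale a p) i ≡ a * coeff p i
  coeff-scale a []      i       = sym (C.zeroʳ a)
  coeff-scale a (b ∷ p) zero    = refl
  coeff-scale a (b ∷ p) (suc i) = coeff-scale a p i

  coeff-neg : ∀ p i → coeff (neg p) i ≡ - coeff p i
  coeff-neg []      i       = sym CP.-0#≈0#
  coeff-neg (a ∷ p) zero    = refl
  coeff-neg (a ∷ p) (suc i) = coeff-neg p i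

  ⊕-cong : ∀ {p p′ q q′} → p ≋ p′ → q ≋ q′ → p ⊕ q ≋ p′ ⊕ q′
  ⊕-cong {p} {p′} {q} {q′} e f = coeffwise λ i → begin
    coeff (p ⊕ q) i           ≡⟨ coeff-⊕ p q i ⟩
    coeff p i + coeff q i     ≡⟨ cong₂ _+_ (at e i) (at f i) ⟩
    coeff p′ i + coeff q′ i   ≡⟨ coeff-⊕ p′ q′ i ⟨
    coeff (p′ ⊕ q′) i         ∎
    where open ≡.≡-Reasoning

  ⊕-comm : ∀ p q → p ⊕ q ≋ q ⊕ p
  ⊕-comm p q = coeffwise λ i →
    trans (coeff-⊕ p q i) (trans (C.+-comm _ _) (sym (coeff-⊕ q p i)))

  ⊕-assoc : ∀ p q r → (p ⊕ q) ⊕ r ≋ p ⊕ (q ⊕ r)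
  ⊕-assoc p q r = coeffwise λ i → begin
    coeff ((p ⊕ q) ⊕ r) i                  ≡⟨ coeff-⊕ (p ⊕ q) r i ⟩
    coeff (p ⊕ q) i + coeff r i            ≡⟨ cong (_+ coeff r i) (coeff-⊕ p q i) ⟩
    (coeff p i + coeff q i) + coeff r i    ≡⟨ C.+-assoc _ _ _ ⟩
    coeff p i + (coeff q i + coeff r i)    ≡⟨ cong (coeff p i +_) (coeff-⊕ q r i) ⟨
    coeff p i + coeff (q ⊕ r) i            ≡⟨ coeff-⊕ p (q ⊕ r) i ⟨
    coeff (p ⊕ (q ⊕ r)) i                  ∎
    where open ≡.≡-Reasoning

  ⊕-identityˡ : ∀ p → [] ⊕ p ≋ p
  ⊕-identityˡ p = ≋-refl

  ⊕-identityʳ : ∀ p → p ⊕ [] ≋ p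
  ⊕-identityʳ []      = ≋-refl
  ⊕-identityʳ (a ∷ p) = ≋-refl

  neg-cong : ∀ {p q} → p ≋ q → neg p ≋ neg q
  neg-cong {p} {q} e = coeffwise λ i →
    trans (coeff-neg p i) (trans (cong -_ (at e i)) (sym (coeff-neg q i)))

  ⊕-inverseʳ : ∀ p → p ⊕ neg p ≋ []
  ⊕-inverseʳ p = coeffwise λ i →
    trans (coeff-⊕ p (neg p) i) (trans (cong (coeff p i +_) (coeff-neg p i)) (C.-‿inverseʳ _))

  ⊕-inverseˡ : ∀ p → neg p ⊕ p ≋ []
  ⊕-inverseˡ p = ≋-trans (⊕-comm (neg p) p) (⊕-inverseʳ p)

  scale-cong : ∀ {a b p q} → a ≡ b → p ≋ q → scale a p ≋ scale b q
  scale-cong {a} {b} {p} {q} a≡b e = coeffwise λ i →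
    trans (coeff-scale a p i) (trans (cong₂ _*_ a≡b (at e i)) (sym (coeff-scale b q i)))

  scale-distribˡ : ∀ a p q → scale a (p ⊕ q) ≋ scale a p ⊕ scale a q
  scale-distribˡ a p q = coeffwise λ i → begin
    coeff (scale a (p ⊕ q)) i                      ≡⟨ coeff-scale a (p ⊕ q) i ⟩
    a * coeff (p ⊕ q) i                            ≡⟨ cong (a *_) (coeff-⊕ p q i) ⟩
    a * (coeff p i + coeff q i)                    ≡⟨ C.distribˡ _ _ _ ⟩
    a * coeff p i + a * coeff q i                  ≡⟨ cong₂ _+_ (coeff-scale a p i) (coeff-scale a q i) ⟨
    coeff (scale a p) i + coeff (scale a q) i      ≡⟨ coeff-⊕ (scale a p) (scale a q) i ⟨
    coeff (scale a p ⊕ scale a q) i                ∎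
    where open ≡.≡-Reasoning

  scale-distribʳ : ∀ a b p → scale (a + b) p ≋ scale a p ⊕ scale b p
  scale-distribʳ a b p = coeffwise λ i → begin
    coeff (scale (a + b) p) i                      ≡⟨ coeff-scale (a + b) p i ⟩
    (a + b) * coeff p i                            ≡⟨ C.distribʳ _ _ _ ⟩
    a * coeff p i + b * coeff p i                  ≡⟨ cong₂ _+_ (coeff-scale a p i) (coeff-scale b p i) ⟨
    coeff (scale a p) i + coeff (scale b p) i      ≡⟨ coeff-⊕ (scale a p) (scale b p) i ⟨
    coeff (scale a p ⊕ scale b p) i                ∎
    where open ≡.≡-Reasoning

  scale-assoc : ∀ a b p → scale a (scale b p) ≋ scale (a * b) p
  scale-assoc a b p = coeffwise λ i → begin
    coeff (scale a (scale b p)) i     ≡⟨ coeff-scale a (scale b p) i ⟩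
    a * coeff (scale b p) i           ≡⟨ cong (a *_) (coeff-scale b p i) ⟩
    a * (b * coeff p i)               ≡⟨ C.*-assoc _ _ _ ⟨
    (a * b) * coeff p i               ≡⟨ coeff-scale (a * b) p i ⟨
    coeff (scale (a * b) p) i         ∎
    where open ≡.≡-Reasoning

  scale-identity : ∀ p → scale 1a p ≋ p
  scale-identity p = coeffwise λ i → trans (coeff-scale 1a p i) (C.*-identityˡ _)

  scale-zeroˡ : ∀ p → scale 0a p ≋ []
  scale-zeroˡ p = coeffwise λ i → trans (coeff-scale 0a p i) (C.zeroˡ _)

  scale-shift : ∀ a p → scale a (shift p) ≋ shift (scale a p)
  scale-shift a p = ∷-cong (C.zeroʳ a) ≋-refl

  shift-⊕ : ∀ p q → shift (p ⊕ q) ≋ shift p ⊕ shift q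
  shift-⊕ p q = ∷-cong (sym (C.+-identityˡ 0a)) ≋-refl

  ⊛-zeroʳ : ∀ p → p ⊛ [] ≋ []
  ⊛-zeroʳ []      = ≋-refl
  ⊛-zeroʳ (a ∷ p) = shift-≋[] (⊛-zeroʳ p)

  ⊛-≋[]ˡ : ∀ {p} q → p ≋ [] → p ⊛ q ≋ []
  ⊛-≋[]ˡ {[]}    q e = ≋-refl
  ⊛-≋[]ˡ {a ∷ p} q e with ∷≋[]⁻ e
  ... | a≡0 , p≋[] =
    ⊕-cong (≋-trans (scale-cong a≡0 ≋-refl) (scale-zeroˡ q)) (shift-≋[] (⊛-≋[]ˡ q p≋[]))

  ⊛-congˡ : ∀ {p p′} q → p ≋ p′ → p ⊛ q ≋ p′ ⊛ q
  ⊛-congˡ {[]}    {p′}     q e = ≋-sym (⊛-≋[]ˡ q (≋-sym e))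
  ⊛-congˡ {a ∷ p} {[]}     q e = ⊛-≋[]ˡ q e
  ⊛-congˡ {a ∷ p} {b ∷ p′} q e with ∷-injective e
  ... | a≡b , p≋p′ = ⊕-cong (scale-cong a≡b ≋-refl) (∷-cong refl (⊛-congˡ q p≋p′))

  ⊛-congʳ : ∀ p {q q′} → q ≋ q′ → p ⊛ q ≋ p ⊛ q′
  ⊛-congʳ []      e = ≋-refl
  ⊛-congʳ (a ∷ p) e = ⊕-cong (scale-cong refl e) (∷-cong refl (⊛-congʳ p e))

  ⊛-cong : ∀ {p p′ q q′} → p ≋ p′ → q ≋ q′ → p ⊛ q ≋ p′ ⊛ q′
  ⊛-cong {p′ = p′} {q = q} e f = ≋-trans (⊛-congˡ q e) (⊛-congʳ p′ f)

  ⊕-interchange : ∀ p q r s → (p ⊕ q) ⊕ (r ⊕ s) ≋ (p ⊕ r) ⊕ (q ⊕ s)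
  ⊕-interchange p q r s = begin
    (p ⊕ q) ⊕ (r ⊕ s)     ≈⟨ ⊕-assoc p q (r ⊕ s) ⟩
    p ⊕ (q ⊕ (r ⊕ s))     ≈⟨ ⊕-cong (≋-refl {p}) (⊕-assoc q r s) ⟨
    p ⊕ ((q ⊕ r) ⊕ s)     ≈⟨ ⊕-cong (≋-refl {p}) (⊕-cong (⊕-comm q r) (≋-refl {s})) ⟩
    p ⊕ ((r ⊕ q) ⊕ s)     ≈⟨ ⊕-cong (≋-refl {p}) (⊕-assoc r q s) ⟩
    p ⊕ (r ⊕ (q ⊕ s))     ≈⟨ ⊕-assoc p r (q ⊕ s) ⟨
    (p ⊕ r) ⊕ (q ⊕ s)     ∎
    where open ≋-Reasoning

  ⊛-distribʳ : ∀ r p q → (p ⊕ q) ⊛ r ≋ (p ⊛ r) ⊕ (q ⊛ r)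
  ⊛-distribʳ r []      q       = ≋-refl
  ⊛-distribʳ r (a ∷ p) []      = ≋-sym (⊕-identityʳ _)
  ⊛-distribʳ r (a ∷ p) (b ∷ q) = begin
    scale (a + b) r ⊕ shift ((p ⊕ q) ⊛ r)
      ≈⟨ ⊕-cong (scale-distribʳ a b r)
                (≋-trans (∷-cong refl (⊛-distribʳ r p q)) (shift-⊕ (p ⊛ r) (q ⊛ r))) ⟩
    (scale a r ⊕ scale b r) ⊕ (shift (p ⊛ r) ⊕ shift (q ⊛ r))
      ≈⟨ ⊕-interchange (scale a r) (scale b r) (shift (p ⊛ r)) (shift (q ⊛ r)) ⟩
    (scale a r ⊕ shift (p ⊛ r)) ⊕ (scale b r ⊕ shift (q ⊛ r)) ∎
    where open ≋-Reasoning

  ⊛-distribˡ : ∀ p q r → p ⊛ (q ⊕ r) ≋ (p ⊛ q) ⊕ (p ⊛ r)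
  ⊛-distribˡ []      q r = ≋-refl
  ⊛-distribˡ (a ∷ p) q r = begin
    scale a (q ⊕ r) ⊕ shift (p ⊛ (q ⊕ r))
      ≈⟨ ⊕-cong (scale-distribˡ a q r)
                (≋-trans (∷-cong refl (⊛-distribˡ p q r)) (shift-⊕ (p ⊛ q) (p ⊛ r))) ⟩
    (scale a q ⊕ scale a r) ⊕ (shift (p ⊛ q) ⊕ shift (p ⊛ r))
      ≈⟨ ⊕-interchange (scale a q) (scale a r) (shift (p ⊛ q)) (shift (p ⊛ r)) ⟩
    (scale a q ⊕ shift (p ⊛ q)) ⊕ (scale a r ⊕ shift (p ⊛ r)) ∎
    where open ≋-Reasoning

  scale-⊛ˡ : ∀ a p q → scale a (p ⊛ q) ≋ scale a p ⊛ q
  scale-⊛ˡ a []      q = ≋-refl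
  scale-⊛ˡ a (b ∷ p) q = begin
    scale a (scale b q ⊕ shift (p ⊛ q))            ≈⟨ scale-distribˡ a (scale b q) (shift (p ⊛ q)) ⟩
    scale a (scale b q) ⊕ scale a (shift (p ⊛ q))
      ≈⟨ ⊕-cong (scale-assoc a b q) (≋-trans (scale-shift a (p ⊛ q)) (∷-cong refl (scale-⊛ˡ a p q))) ⟩
    scale (a * b) q ⊕ shift (scale a p ⊛ q)        ∎
    where open ≋-Reasoning

  scale-⊛ʳ : ∀ a p q → scale a (p ⊛ q) ≋ p ⊛ scale a q
  scale-⊛ʳ a []      q = ≋-refl
  scale-⊛ʳ a (b ∷ p) q = begin
    scale a (scale b q ⊕ shift (p ⊛ q))            ≈⟨ scale-distribˡ a (scale b q) (shift (p ⊛ q)) ⟩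
    scale a (scale b q) ⊕ scale a (shift (p ⊛ q))
      ≈⟨ ⊕-cong (≋-trans (scale-assoc a b q)
                  (≋-trans (scale-cong (C.*-comm a b) ≋-refl) (≋-sym (scale-assoc b a q))))
                (≋-trans (scale-shift a (p ⊛ q)) (∷-cong refl (scale-⊛ʳ a p q))) ⟩
    scale b (scale a q) ⊕ shift (p ⊛ scale a q)    ∎
    where open ≋-Reasoning

  shift-⊛ : ∀ p q → shift p ⊛ q ≋ shift (p ⊛ q)
  shift-⊛ p q = ≋-trans (⊕-cong (scale-zeroˡ q) ≋-refl) (⊕-identityˡ (shift (p ⊛ q)))

  ⊛-shift : ∀ p q → p ⊛ shift q ≋ shift (p ⊛ q)
  ⊛-shift []      q = ≋-sym (shift-≋[] ≋-refl)
  ⊛-shift (a ∷ p) q = begin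
    scale a (shift q) ⊕ shift (p ⊛ shift q)         ≈⟨ ⊕-cong (scale-shift a q) (∷-cong refl (⊛-shift p q)) ⟩
    shift (scale a q) ⊕ shift (shift (p ⊛ q))       ≈⟨ shift-⊕ (scale a q) (shift (p ⊛ q)) ⟨
    shift (scale a q ⊕ shift (p ⊛ q))               ∎
    where open ≋-Reasoning

  ⊛-identityˡ : ∀ p → one ⊛ p ≋ p
  ⊛-identityˡ p = ≋-trans (⊕-cong (scale-identity p) (shift-≋[] ≋-refl)) (⊕-identityʳ p)

  ⊛-identityʳ : ∀ p → p ⊛ one ≋ p
  ⊛-identityʳ []      = ≋-refl
  ⊛-identityʳ (a ∷ p) = ∷-cong (trans (C.+-identityʳ _) (C.*-identityʳ a)) (⊛-identityʳ p)

  ⊛-constʳ : ∀ p a → p ⊛ (a ∷ []) ≋ scale a p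
  ⊛-constʳ p a = begin
    p ⊛ (a ∷ [])        ≈⟨ ⊛-congʳ p (∷-cong (sym (C.*-identityʳ a)) ≋-refl) ⟩
    p ⊛ scale a one     ≈⟨ scale-⊛ʳ a p one ⟨
    scale a (p ⊛ one)   ≈⟨ scale-cong refl (⊛-identityʳ p) ⟩
    scale a p           ∎
    where open ≋-Reasoning

  ⊛-comm : ∀ p q → p ⊛ q ≋ q ⊛ p
  ⊛-comm []      q = ≋-sym (⊛-zeroʳ q)
  ⊛-comm (a ∷ p) q = begin
    scale a q ⊕ shift (p ⊛ q)
      ≈⟨ ⊕-cong (≋-sym (⊛-constʳ q a)) (≋-trans (∷-cong refl (⊛-comm p q)) (≋-sym (⊛-shift q p))) ⟩
    (q ⊛ (a ∷ [])) ⊕ (q ⊛ shift p)    ≈⟨ ⊛-distribˡ q (a ∷ []) (shift p) ⟨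
    q ⊛ ((a ∷ []) ⊕ shift p)          ≈⟨ ⊛-congʳ q (∷-cong (C.+-identityʳ a) ≋-refl) ⟩
    q ⊛ (a ∷ p)                       ∎
    where open ≋-Reasoning

  ⊛-assoc : ∀ p q r → (p ⊛ q) ⊛ r ≋ p ⊛ (q ⊛ r)
  ⊛-assoc []      q r = ≋-refl
  ⊛-assoc (a ∷ p) q r = begin
    (scale a q ⊕ shift (p ⊛ q)) ⊛ r        ≈⟨ ⊛-distribʳ r (scale a q) (shift (p ⊛ q)) ⟩
    (scale a q ⊛ r) ⊕ (shift (p ⊛ q) ⊛ r)
      ≈⟨ ⊕-cong (≋-sym (scale-⊛ˡ a q r)) (≋-trans (shift-⊛ (p ⊛ q) r) (∷-cong refl (⊛-assoc p q r))) ⟩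
    scale a (q ⊛ r) ⊕ shift (p ⊛ (q ⊛ r))  ∎
    where open ≋-Reasoning

  polynomialRing : CommutativeRing 0ℓ 0ℓ
  polynomialRing = record
    { Carrier = Poly ; _≈_ = _≋_ ; _+_ = _⊕_ ; _*_ = _⊛_ ; -_ = neg ; 0# = [] ; 1# = one
    ; isCommutativeRing = record
      { isRing = record
        { +-isAbelianGroup = record
          { isGroup = record
            { isMonoid = record
              { isSemigroup = record
                { isMagma = record { isEquivalence = ≋-isEquivalence ; ∙-cong = ⊕-cong }
                ; assoc = ⊕-assoc }
              ; identity = ⊕-identityˡ , ⊕-identityʳ }
            ; inverse = ⊕-inverseˡ , ⊕-inverseʳ
            ; ⁻¹-cong = neg-cong }
          ; comm = ⊕-comm }
        ; *-cong = ⊛-cong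
        ; *-assoc = ⊛-assoc
        ; *-identity = ⊛-identityˡ , ⊛-identityʳ
        ; distrib = ⊛-distribˡ , ⊛-distribʳ }
      ; *-comm = ⊛-comm } }

  open CommutativeRing polynomialRing public
    using () renaming (_-_ to _⊖_)
  open Congruence polynomialRing public
  open import Algebra.Definitions.RawSemiring (Semiring.rawSemiring (CommutativeRing.semiring polynomialRing)) public
    using () renaming (_^_ to _^ₚ_)

  open import Algebra.Definitions.RawSemiring (Semiring.rawSemiring C.semiring) public
    using () renaming (_^_ to _^ᶜ_)
  open IntegerEmbedding.Solver polynomialRing using (solve; _:+_; _:-_; _:*_; _:=_)

  ∣ₚ⇒∣ : ∀ {p q} → p ∣ₚ q → p ∣ q
  ∣ₚ⇒∣ {p} (r , pr≈q) = r , ≋-trans (⊛-comm r p) (coeffwise pr≈q)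

  coeff-⊖ : ∀ p q i → coeff (p ⊖ q) i ≡ coeff p i - coeff q i
  coeff-⊖ p q i = trans (coeff-⊕ p (neg q) i) (cong (coeff p i +_) (coeff-neg q i))

  record DegreeBelow (p : Poly) (d : ℕ) : Set where
    constructor degreeBelow
    field vanishes : ∀ i → d ≤ i → coeff p i ≡ 0a
  open DegreeBelow public

  DegreeBelow-mono : ∀ {p d e} → d ≤ e → DegreeBelow p d → DegreeBelow p e
  DegreeBelow-mono d≤e p<d = degreeBelow λ i e≤i → vanishes p<d i (ℕP.≤-trans d≤e e≤i)

  DegreeBelow-resp : ∀ {p q d} → p ≋ q → DegreeBelow p d → DegreeBelow q d
  DegreeBelow-resp p≋q p<d = degreeBelow λ i d≤i → trans (sym (at p≋q i)) (vanishes p<d i d≤i)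

  DegreeBelow-length : ∀ p → DegreeBelow p (length p)
  DegreeBelow-length p = degreeBelow (go p)
    where
    go : ∀ p i → length p ≤ i → coeff p i ≡ 0a
    go []      i       _         = refl
    go (a ∷ p) (suc i) (s≤s l≤i) = go p i l≤i

  ≋[]⇒DegreeBelow : ∀ {p} d → p ≋ [] → DegreeBelow p d
  ≋[]⇒DegreeBelow d p≋[] = degreeBelow λ i _ → at p≋[] i

  DegreeBelow-zero : ∀ {p} → DegreeBelow p 0 → p ≋ []
  DegreeBelow-zero p<0 = coeffwise λ i → vanishes p<0 i z≤n

  DegreeBelow-tail : ∀ {a p d} → DegreeBelow (a ∷ p) (suc d) → DegreeBelow p d
  DegreeBelow-tail ap<1+d = degreeBelow λ i d≤i → vanishes ap<1+d (suc i) (s≤s d≤i)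

  DegreeBelow-one : ∀ {p} → DegreeBelow p 1 → p ≋ coeff p 0 ∷ []
  DegreeBelow-one {[]}    _    = ≋-sym (shift-≋[] ≋-refl)
  DegreeBelow-one {a ∷ p} ap<1 = ∷-cong refl (DegreeBelow-zero (DegreeBelow-tail ap<1))

  DegreeBelow-pred : ∀ {p d} → DegreeBelow p (suc d) → coeff p d ≡ 0a → DegreeBelow p d
  DegreeBelow-pred {p} {d} p<1+d p[d]≡0 = degreeBelow vanishes′
    where
    vanishes′ : ∀ i → d ≤ i → coeff p i ≡ 0a
    vanishes′ i d≤i with ℕP.m≤n⇒m<n∨m≡n d≤i
    ... | inj₁ d<i  = vanishes p<1+d i d<i
    ... | inj₂ refl = p[d]≡0

  DegreeBelow-⊕ : ∀ {p q d} → DegreeBelow p d → DegreeBelow q d → DegreeBelow (p ⊕ q) d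
  DegreeBelow-⊕ {p} {q} p<d q<d = degreeBelow λ i d≤i → begin
    coeff (p ⊕ q) i          ≡⟨ coeff-⊕ p q i ⟩
    coeff p i + coeff q i    ≡⟨ cong₂ _+_ (vanishes p<d i d≤i) (vanishes q<d i d≤i) ⟩
    0a + 0a                  ≡⟨ C.+-identityˡ 0a ⟩
    0a                       ∎
    where open ≡.≡-Reasoning

  DegreeBelow-scale : ∀ {p d} a → DegreeBelow p d → DegreeBelow (scale a p) d
  DegreeBelow-scale {p} a p<d = degreeBelow λ i d≤i →
    trans (coeff-scale a p i) (trans (cong (a *_) (vanishes p<d i d≤i)) (C.zeroʳ a))

  DegreeBelow-neg : ∀ {p d} → DegreeBelow p d → DegreeBelow (neg p) d
  DegreeBelow-neg {p} p<d = degreeBelow λ i d≤i →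
    trans (coeff-neg p i) (trans (cong -_ (vanishes p<d i d≤i)) CP.-0#≈0#)

  DegreeBelow-shift : ∀ {p d} → DegreeBelow p d → DegreeBelow (shift p) (suc d)
  DegreeBelow-shift p<d = degreeBelow λ { (suc i) (s≤s d≤i) → vanishes p<d i d≤i }

  padTo : ℕ → Poly → Poly
  padTo zero    p       = []
  padTo (suc k) []      = 0a ∷ padTo k []
  padTo (suc k) (a ∷ p) = a ∷ padTo k p

  length-padTo : ∀ k p → length (padTo k p) ≡ k
  length-padTo zero    p       = refl
  length-padTo (suc k) []      = cong suc (length-padTo k [])
  length-padTo (suc k) (a ∷ p) = cong suc (length-padTo k p)

  padTo-≋ : ∀ k {p} → DegreeBelow p k → padTo k p ≋ p
  padTo-≋ zero    p<0                = ≋-sym (DegreeBelow-zero p<0)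
  padTo-≋ (suc k) {[]}    _          = ∷≋[]⁺ refl (padTo-≋ k (≋[]⇒DegreeBelow k ≋-refl))
  padTo-≋ (suc k) {a ∷ p} ap<1+k     = ∷-cong refl (padTo-≋ k (DegreeBelow-tail ap<1+k))

  ≋∧length⇒≡ : ∀ {p q} → p ≋ q → length p ≡ length q → p ≡ q
  ≋∧length⇒≡ {[]}    {[]}    _     _       = refl
  ≋∧length⇒≡ {a ∷ p} {b ∷ q} ap≋bq 1+l≡1+l =
    cong₂ _∷_ (at ap≋bq 0) (≋∧length⇒≡ (proj₂ (∷-injective ap≋bq)) (ℕP.suc-injective 1+l≡1+l))

  ⊛-leading : ∀ p q a b → DegreeBelow p (suc a) → DegreeBelow q (suc b) →
              DegreeBelow (p ⊛ q) (suc (a ℕ.+ b)) × coeff (p ⊛ q) (a ℕ.+ b) ≡ coeff p a * coeff q b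
  ⊛-leading []      q a       b _   _   = ≋[]⇒DegreeBelow _ ≋-refl , sym (C.zeroˡ _)
  ⊛-leading (c ∷ p) q zero    b cp<1 q<1+b =
    DegreeBelow-resp (≋-sym cp≋cq) (DegreeBelow-scale c q<1+b) , trans (at cp≋cq b) (coeff-scale c q b)
    where
    cp≋cq : (c ∷ p) ⊛ q ≋ scale c q
    cp≋cq = ≋-trans (⊕-cong ≋-refl (shift-≋[] (⊛-≋[]ˡ q (DegreeBelow-zero (DegreeBelow-tail cp<1)))))
                    (⊕-identityʳ (scale c q))
  ⊛-leading (c ∷ p) q (suc a) b cp<2+a q<1+b with ⊛-leading p q a b (DegreeBelow-tail cp<2+a) q<1+b
  ... | pq<1+a+b , pq[a+b] =
    DegreeBelow-⊕ (DegreeBelow-mono b<2+a+b (DegreeBelow-scale c q<1+b)) (DegreeBelow-shift pq<1+a+b) ,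
    (begin
      coeff (scale c q ⊕ shift (p ⊛ q)) (suc (a ℕ.+ b))      ≡⟨ coeff-⊕ (scale c q) _ (suc (a ℕ.+ b)) ⟩
      coeff (scale c q) (suc (a ℕ.+ b)) + coeff (p ⊛ q) (a ℕ.+ b)
        ≡⟨ cong₂ _+_ (vanishes (DegreeBelow-scale c q<1+b) _ (s≤s (ℕP.m≤n+m b a))) pq[a+b] ⟩
      0a + coeff p a * coeff q b                            ≡⟨ C.+-identityˡ _ ⟩
      coeff p a * coeff q b                                 ∎)
    where
    open ≡.≡-Reasoning
    b<2+a+b : suc b ≤ suc (suc (a ℕ.+ b))
    b<2+a+b = s≤s (ℕP.≤-trans (ℕP.m≤n+m b a) (ℕP.n≤1+n _))

  monomial : ℕ → A → Poly
  monomial zero    a = a ∷ []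
  monomial (suc j) a = shift (monomial j a)

  DegreeBelow-monomial : ∀ j a → DegreeBelow (monomial j a) (suc j)
  DegreeBelow-monomial zero    a = DegreeBelow-length (a ∷ [])
  DegreeBelow-monomial (suc j) a = DegreeBelow-shift (DegreeBelow-monomial j a)

  coeff-monomial : ∀ j a → coeff (monomial j a) j ≡ a
  coeff-monomial zero    a = refl
  coeff-monomial (suc j) a = coeff-monomial j a

  -- Pseudo-division

  record PseudoDivision (T : Poly) (d : ℕ) (R : Poly) : Set where
    constructor pseudoDivision
    field
      exponent        : ℕ
      quotient        : Poly
      remainder       : Poly
      equation        : scale (coeff T d ^ᶜ exponent) R ≋ (T ⊛ quotient) ⊕ remainder
      remainder-bound : DegreeBelow remainder d

  eliminate-leading : ∀ {T R} d j → DegreeBelow T (suc d) → DegreeBelow R (suc (d ℕ.+ j)) →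
    DegreeBelow (scale (coeff T d) R ⊖ (T ⊛ monomial j (coeff R (d ℕ.+ j)))) (d ℕ.+ j)
  eliminate-leading {T} {R} d j T<1+d R<1+k = DegreeBelow-pred R′<1+k R′[k]≡0
    where
    open ≡.≡-Reasoning
    k : ℕ
    k = d ℕ.+ j
    c : A
    c = coeff T d
    r : A
    r = coeff R k
    TM : Poly
    TM = T ⊛ monomial j r
    TM-leading : DegreeBelow TM (suc k) × coeff TM k ≡ c * coeff (monomial j r) j
    TM-leading = ⊛-leading T (monomial j r) d j T<1+d (DegreeBelow-monomial j r)
    R′<1+k : DegreeBelow (scale c R ⊖ TM) (suc k)
    R′<1+k = DegreeBelow-⊕ (DegreeBelow-scale c R<1+k) (DegreeBelow-neg (proj₁ TM-leading))
    R′[k]≡0 : coeff (scale c R ⊖ TM) k ≡ 0a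
    R′[k]≡0 = begin
      coeff (scale c R ⊖ TM) k           ≡⟨ coeff-⊖ (scale c R) TM k ⟩
      coeff (scale c R) k - coeff TM k   ≡⟨ cong₂ _-_ (coeff-scale c R k) (proj₂ TM-leading) ⟩
      c * r - c * coeff (monomial j r) j ≡⟨ cong (λ x → c * r - c * x) (coeff-monomial j r) ⟩
      c * r - c * r                      ≡⟨ C.-‿inverseʳ (c * r) ⟩
      0a                                 ∎

  pseudoDivision-step : ∀ {T d R} M → PseudoDivision T d (scale (coeff T d) R ⊖ (T ⊛ M)) →
                        PseudoDivision T d R
  pseudoDivision-step {T} {d} {R} M (pseudoDivision e Q U eq U<d) =
    pseudoDivision (suc e) (Q ⊕ scale cᵉ M) U eq′ U<d
    where
    open ≋-Reasoning
    c : A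
    c = coeff T d
    cᵉ : A
    cᵉ = c ^ᶜ e
    eq′ : scale (c * cᵉ) R ≋ (T ⊛ (Q ⊕ scale cᵉ M)) ⊕ U
    eq′ = begin
      scale (c * cᵉ) R                              ≈⟨ scale-cong (C.*-comm c cᵉ) ≋-refl ⟩
      scale (cᵉ * c) R                              ≈⟨ scale-assoc cᵉ c R ⟨
      scale cᵉ (scale c R)
        ≈⟨ scale-cong refl (solve 2 (λ x y → x := (x :- y) :+ y) ≋-refl (scale c R) (T ⊛ M)) ⟩
      scale cᵉ ((scale c R ⊖ (T ⊛ M)) ⊕ (T ⊛ M))    ≈⟨ scale-distribˡ cᵉ _ (T ⊛ M) ⟩
      scale cᵉ (scale c R ⊖ (T ⊛ M)) ⊕ scale cᵉ (T ⊛ M) ≈⟨ ⊕-cong eq (scale-⊛ʳ cᵉ T M) ⟩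
      ((T ⊛ Q) ⊕ U) ⊕ (T ⊛ scale cᵉ M)
        ≈⟨ solve 4 (λ t q u m → (t :* q :+ u) :+ t :* m := t :* (q :+ m) :+ u) ≋-refl T Q U (scale cᵉ M) ⟩
      (T ⊛ (Q ⊕ scale cᵉ M)) ⊕ U                     ∎

  pseudoDivision-trivial : ∀ {T d R} → DegreeBelow R d → PseudoDivision T d R
  pseudoDivision-trivial {T} {R = R} R<d =
    pseudoDivision 0 [] R (≋-trans (scale-identity R) (≋-sym (⊕-cong (⊛-zeroʳ T) ≋-refl))) R<d

  pseudoDivide : ∀ {T d} → DegreeBelow T (suc d) → ∀ k R → DegreeBelow R k → PseudoDivision T d R
  pseudoDivide         T<1+d zero    R R<0   = pseudoDivision-trivial (DegreeBelow-mono z≤n R<0)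
  pseudoDivide {T} {d} T<1+d (suc k) R R<1+k with d ℕP.≤? k
  ... | no  d≰k = pseudoDivision-trivial (DegreeBelow-mono (ℕP.≰⇒> d≰k) R<1+k)
  ... | yes d≤k = pseudoDivision-step M (pseudoDivide T<1+d k R′ R′<k)
    where
    j : ℕ
    j = k ∸ d
    d+j≡k : d ℕ.+ j ≡ k
    d+j≡k = ℕP.m+[n∸m]≡n d≤k
    M : Poly
    M = monomial j (coeff R (d ℕ.+ j))
    R′ : Poly
    R′ = scale (coeff T d) R ⊖ (T ⊛ M)
    R′<k : DegreeBelow R′ k
    R′<k = subst (DegreeBelow R′) d+j≡k
                 (eliminate-leading d j T<1+d (subst (λ k → DegreeBelow R (suc k)) (sym d+j≡k) R<1+k))

  record Division (T : Poly) (d : ℕ) (R : Poly) : Set where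
    constructor division
    field
      quotient        : Poly
      remainder       : Poly
      equation        : R ≋ (T ⊛ quotient) ⊕ remainder
      remainder-bound : DegreeBelow remainder d

  divideMonic : ∀ {T d} → DegreeBelow T (suc d) → coeff T d ≡ 1a → ∀ R → Division T d R
  divideMonic {T} {d} T<1+d T[d]≡1 R with pseudoDivide T<1+d (length R) R (DegreeBelow-length R)
  ... | pseudoDivision e Q U eq U<d = division Q U (≋-trans (≋-sym scale≋R) eq) U<d
    where
    1^ᶜn≡1 : ∀ n → 1a ^ᶜ n ≡ 1a
    1^ᶜn≡1 zero    = refl
    1^ᶜn≡1 (suc n) = trans (C.*-identityˡ _) (1^ᶜn≡1 n)
    scale≋R : scale (coeff T d ^ᶜ e) R ≋ R
    scale≋R = ≋-trans (scale-cong (trans (cong (_^ᶜ e) T[d]≡1) (1^ᶜn≡1 e)) ≋-refl) (scale-identity R)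

  strip-≋ : ∀ p → strip p ≋ p
  strip-≋ []      = ≋-refl
  strip-≋ (a ∷ p) with strip p | strip-≋ p
  ... | b ∷ q | q≋p = ∷-cong refl q≋p
  ... | []    | []≋p with a ≟ 0a
  ...   | yes a≡0 = ≋-sym (∷≋[]⁺ a≡0 (≋-sym []≋p))
  ...   | no  _   = ∷-cong refl []≋p

  strip-view : ∀ p → strip p ≡ [] ⊎ Σ A λ b → Σ Poly λ q → strip p ≡ b ∷ q × lastA (b ∷ q) ≢ 0a
  strip-view []      = inj₁ refl
  strip-view (a ∷ p) with strip p | strip-view p
  ... | b ∷ q | inj₂ (_ , _ , refl , last≢0) = inj₂ (a , b ∷ q , refl , last≢0)
  ... | []    | _ with a ≟ 0a
  ...   | yes _   = inj₁ refl
  ...   | no  a≢0 = inj₂ (a , [] , refl , a≢0)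

  private
    strip≡[]⇒≋[] : ∀ p → strip p ≡ [] → p ≋ []
    strip≡[]⇒≋[] p s≡[] = ≋-trans (≋-sym (strip-≋ p)) (≋-reflexive s≡[])

    coeff-lastA : ∀ b q → coeff (b ∷ q) (length q) ≡ lastA (b ∷ q)
    coeff-lastA b []      = refl
    coeff-lastA b (c ∷ q) = coeff-lastA c q

    strip≡∷⇒coeff-deg : ∀ p {b q} → strip p ≡ b ∷ q →
                        deg p ≡ length q × coeff p (deg p) ≡ lastA (b ∷ q)
    strip≡∷⇒coeff-deg p {b} {q} s≡bq = deg≡ , (begin
      coeff p (deg p)          ≡⟨ cong (coeff p) deg≡ ⟩
      coeff p (length q)       ≡⟨ at (strip-≋ p) (length q) ⟨
      coeff (strip p) (length q) ≡⟨ cong (λ s → coeff s (length q)) s≡bq ⟩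
      coeff (b ∷ q) (length q) ≡⟨ coeff-lastA b q ⟩
      lastA (b ∷ q)            ∎)
      where
      open ≡.≡-Reasoning
      deg≡ : deg p ≡ length q
      deg≡ = cong (λ s → length s ∸ 1) s≡bq

  deg-bound : ∀ p → DegreeBelow p (suc (deg p))
  deg-bound p with strip-view p
  ... | inj₁ s≡[]               = ≋[]⇒DegreeBelow _ (strip≡[]⇒≋[] p s≡[])
  ... | inj₂ (b , q , s≡bq , _) =
    subst (λ n → DegreeBelow p (suc n)) (sym (proj₁ (strip≡∷⇒coeff-deg p s≡bq)))
          (DegreeBelow-resp (≋-trans (≋-reflexive (sym s≡bq)) (strip-≋ p)) (DegreeBelow-length (b ∷ q)))

  lead≡coeff-deg : ∀ p → lead p ≡ coeff p (deg p)
  lead≡coeff-deg p with strip-view p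
  ... | inj₁ s≡[]               = trans (cong lastA s≡[]) (sym (at (strip≡[]⇒≋[] p s≡[]) (deg p)))
  ... | inj₂ (b , q , s≡bq , _) = trans (cong lastA s≡bq) (sym (proj₂ (strip≡∷⇒coeff-deg p s≡bq)))

  ≋[]⊎coeff-deg≢0 : ∀ p → p ≋ [] ⊎ coeff p (deg p) ≢ 0a
  ≋[]⊎coeff-deg≢0 p with strip-view p
  ... | inj₁ s≡[]                     = inj₁ (strip≡[]⇒≋[] p s≡[])
  ... | inj₂ (b , q , s≡bq , last≢0) =
    inj₂ (λ c≡0 → last≢0 (trans (sym (proj₂ (strip≡∷⇒coeff-deg p s≡bq))) c≡0))

  ≋[]⇒deg≡0 : ∀ {p} → p ≋ [] → deg p ≡ 0
  ≋[]⇒deg≡0 {p} p≋[] with strip-view p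
  ... | inj₁ s≡[]                     = cong (λ s → length s ∸ 1) s≡[]
  ... | inj₂ (b , q , s≡bq , last≢0) =
    ⊥-elim (last≢0 (trans (sym (proj₂ (strip≡∷⇒coeff-deg p s≡bq))) (at p≋[] (deg p))))

  deg-exact : ∀ {p d} → DegreeBelow p (suc d) → coeff p d ≢ 0a → deg p ≡ d
  deg-exact {p} {d} p<1+d p[d]≢0 with ≋[]⊎coeff-deg≢0 p
  ... | inj₁ p≋[]    = ⊥-elim (p[d]≢0 (at p≋[] d))
  ... | inj₂ lead≢0 with ℕP.<-cmp (deg p) d
  ...   | tri< deg<d _ _ = ⊥-elim (p[d]≢0 (vanishes (deg-bound p) d deg<d))
  ...   | tri≈ _ deg≡d _ = deg≡d
  ...   | tri> _ _ d<deg = ⊥-elim (lead≢0 (vanishes p<1+d (deg p) d<deg))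

  deg≡0⇒constant : ∀ {p} → deg p ≡ 0 → p ≋ coeff p 0 ∷ []
  deg≡0⇒constant {p} deg≡0 = DegreeBelow-one (subst (λ n → DegreeBelow p (suc n)) deg≡0 (deg-bound p))

  reverse-lastA : ∀ b q → Σ Poly λ rest → reverse (b ∷ q) ≡ lastA (b ∷ q) ∷ rest
  reverse-lastA b []      = [] , refl
  reverse-lastA b (c ∷ q) with reverse-lastA c q
  ... | rest , rev≡ = rest ∷ʳ b , trans (ListP.unfold-reverse b (c ∷ q)) (cong (_∷ʳ b) rev≡)

  reverse-strip : ∀ p → lead p ≢ 0a → Σ Poly λ rest → reverse (strip p) ≡ lead p ∷ rest
  reverse-strip p lead≢0 with strip-view p
  ... | inj₁ s≡[]               = ⊥-elim (lead≢0 (cong lastA s≡[]))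
  ... | inj₂ (b , q , s≡bq , _) with reverse-lastA b q
  ...   | rest , rev≡ = rest , trans (cong reverse s≡bq) (trans rev≡ (cong (_∷ rest) (cong lastA (sym s≡bq))))

  X : Poly
  X = 0a ∷ 1a ∷ []

  compose : Poly → Poly → Poly
  compose []      q = []
  compose (a ∷ g) q = (a ∷ []) ⊕ (q ⊛ compose g q)

  ∷≋const⊕X⊛ : ∀ a p → a ∷ p ≋ (a ∷ []) ⊕ (X ⊛ p)
  ∷≋const⊕X⊛ a p = ≋-sym (begin
    (a ∷ []) ⊕ (X ⊛ p)         ≈⟨ ⊕-cong (≋-refl {a ∷ []}) (shift-⊛ one p) ⟩
    (a ∷ []) ⊕ shift (one ⊛ p) ≈⟨ ∷-cong (C.+-identityʳ a) (⊛-identityˡ p) ⟩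
    a ∷ p                      ∎)
    where open ≋-Reasoning

  compose-one : ∀ g → compose g one ≋ foldr _+_ 0a g ∷ []
  compose-one []      = ≋-sym (shift-≋[] ≋-refl)
  compose-one (a ∷ g) = ⊕-cong (≋-refl {a ∷ []}) (≋-trans (⊛-identityˡ (compose g one)) (compose-one g))

  compose-cong-mod : ∀ g {q q′ m} → q ≈ q′ mod m → compose g q ≈ compose g q′ mod m
  compose-cong-mod []      q≈q′ = ≈⇒≈mod ≋-refl
  compose-cong-mod (a ∷ g) q≈q′ =
    mod-+ (≈⇒≈mod (≋-refl {a ∷ []})) (mod-* q≈q′ (compose-cong-mod g q≈q′))

ℤ-coefficients : CoefficientRing
ℤ-coefficients = record
  { Carrier = ℤ ; 0# = ℤ.0ℤ ; 1# = ℤ.1ℤ ; _+_ = ℤ._+_ ; _*_ = ℤ._*_ ; -_ = ℤ.-_ ; _≟_ = ℤ._≟_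
  ; isCommutativeRing = ℤP.+-*-isCommutativeRing }

ℚ-coefficients : CoefficientRing
ℚ-coefficients = record
  { Carrier = ℚ ; 0# = 0ℚ ; 1# = 1ℚ ; _+_ = ℚ._+_ ; _*_ = ℚ._*_ ; -_ = ℚ.-_ ; _≟_ = ℚP._≟_
  ; isCommutativeRing = ℚP.+-*-isCommutativeRing }

𝔽₂-coefficients : CoefficientRing
𝔽₂-coefficients = record
  { Carrier = Bool ; 0# = false ; 1# = true ; _+_ = _xor_ ; _*_ = _∧_ ; -_ = id ; _≟_ = BoolP._≟_
  ; isCommutativeRing = CommutativeRing.isCommutativeRing BoolP.xor-∧-commutativeRing }

module ℤ[X] = Polynomials ℤ-coefficients
module ℚ[X] = Polynomials ℚ-coefficients
module 𝔽₂[X] = Polynomials 𝔽₂-coefficients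

module PolynomialMap (R S : CoefficientRing) (h : CoefficientRing.Carrier R → CoefficientRing.Carrier S)
  (h-0 : h (CoefficientRing.0# R) ≡ CoefficientRing.0# S) (h-1 : h (CoefficientRing.1# R) ≡ CoefficientRing.1# S)
  (h-+ : ∀ a b → h (CoefficientRing._+_ R a b) ≡ CoefficientRing._+_ S (h a) (h b))
  (h-* : ∀ a b → h (CoefficientRing._*_ R a b) ≡ CoefficientRing._*_ S (h a) (h b)) where

  private
    module R[X] = Polynomials R
    module S[X] = Polynomials S
    open ≡ using (refl; sym; trans; cong; cong₂)

  map-⊕ : ∀ p q → map h (p R[X].⊕ q) ≡ map h p S[X].⊕ map h q
  map-⊕ []      q       = refl
  map-⊕ (a ∷ p) []      = refl
  map-⊕ (a ∷ p) (b ∷ q) = cong₂ _∷_ (h-+ a b) (map-⊕ p q)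

  map-scale : ∀ a p → map h (R[X].scale a p) ≡ S[X].scale (h a) (map h p)
  map-scale a []      = refl
  map-scale a (b ∷ p) = cong₂ _∷_ (h-* a b) (map-scale a p)

  map-⊛ : ∀ p q → map h (p R[X].⊛ q) ≡ map h p S[X].⊛ map h q
  map-⊛ []      q = refl
  map-⊛ (a ∷ p) q = trans (map-⊕ (R[X].scale a q) (R[X].shift (p R[X].⊛ q)))
                          (cong₂ S[X]._⊕_ (map-scale a q) (cong₂ _∷_ h-0 (map-⊛ p q)))

  coeff-map : ∀ p i → S[X].coeff (map h p) i ≡ h (R[X].coeff p i)
  coeff-map []      i       = sym h-0
  coeff-map (a ∷ p) zero    = refl
  coeff-map (a ∷ p) (suc i) = coeff-map p i

  map-cong : ∀ {p q} → p R[X].≋ q → map h p S[X].≋ map h q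
  map-cong {p} {q} p≋q = S[X].coeffwise λ i →
    trans (coeff-map p i) (trans (cong h (R[X].at p≋q i)) (sym (coeff-map q i)))

  map-∣ : ∀ {d p} → d R[X].∣ p → map h d S[X].∣ map h p
  map-∣ {d} {p} (q R[X]., qd≋p) =
    map h q S[X]., S[X].≋-trans (S[X].≋-reflexive (sym (map-⊛ q d))) (map-cong qd≋p)

  map-DegreeBelow : ∀ {p d} → R[X].DegreeBelow p d → S[X].DegreeBelow (map h p) d
  map-DegreeBelow {p} p<d = S[X].degreeBelow λ i d≤i →
    trans (coeff-map p i) (trans (cong h (R[X].vanishes p<d i d≤i)) h-0)

  map-X : map h R[X].X ≡ S[X].X
  map-X = cong₂ _∷_ h-0 (cong (_∷ []) h-1)

  map-^ₚ : ∀ q k → map h (q R[X].^ₚ k) ≡ map h q S[X].^ₚ k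
  map-^ₚ q zero    = cong (_∷ []) h-1
  map-^ₚ q (suc k) = trans (map-⊛ q (q R[X].^ₚ k)) (cong (map h q S[X].⊛_) (map-^ₚ q k))

  map-compose : ∀ g q → map h (R[X].compose g q) ≡ S[X].compose (map h g) (map h q)
  map-compose []      q = refl
  map-compose (a ∷ g) q =
    trans (map-⊕ (a ∷ []) (q R[X].⊛ R[X].compose g q))
          (cong ((h a ∷ []) S[X].⊕_) (trans (map-⊛ q (R[X].compose g q)) (cong (map h q S[X].⊛_) (map-compose g q))))

module Evaluation {c ℓ} (K : CommutativeRing c ℓ) where

  open CommutativeRing K
  open InRing K
  open IntegerEmbedding K using (intK-+; intK-*; module Solver)
  open Solver using (solve; _:+_; _:-_; _:*_; _:=_; con)
  open ℤ[X] using (_≋_; at; _⊕_; _⊛_; scale; compose; X; _^ₚ_; ∷-injective; ∷≋[]⁻; ≋-sym)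
  open SetoidReasoning setoid

  eval-≋[] : ∀ {p} x → p ≋ [] → eval p x ≈ 0#
  eval-≋[] {[]}    x _ = refl
  eval-≋[] {a ∷ p} x ap≋[] with ∷≋[]⁻ ap≋[]
  ... | ≡.refl , p≋[] = begin
    0# + x * eval p x    ≈⟨ +-congˡ (*-congˡ (eval-≋[] x p≋[])) ⟩
    0# + x * 0#          ≈⟨ solve 1 (λ x → con ℤ.0ℤ :+ x :* con ℤ.0ℤ := con ℤ.0ℤ) refl x ⟩
    0#                   ∎

  eval-cong : ∀ {p q} x → p ≋ q → eval p x ≈ eval q x
  eval-cong {[]}    {q}     x []≋q  = sym (eval-≋[] x (≋-sym []≋q))
  eval-cong {a ∷ p} {[]}    x ap≋[] = eval-≋[] x ap≋[]
  eval-cong {a ∷ p} {b ∷ q} x ap≋bq with ∷-injective ap≋bq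
  ... | ≡.refl , p≋q = +-congˡ (*-congˡ (eval-cong x p≋q))

  eval-⊕ : ∀ p q x → eval (p ⊕ q) x ≈ eval p x + eval q x
  eval-⊕ []      q       x = sym (+-identityˡ _)
  eval-⊕ (a ∷ p) []      x = sym (+-identityʳ _)
  eval-⊕ (a ∷ p) (b ∷ q) x = begin
    intK (a ℤ.+ b) + x * eval (p ⊕ q) x             ≈⟨ +-cong (intK-+ a b) (*-congˡ (eval-⊕ p q x)) ⟩
    (intK a + intK b) + x * (eval p x + eval q x)
      ≈⟨ solve 5 (λ u v w y z → (u :+ v) :+ w :* (y :+ z) := (u :+ w :* y) :+ (v :+ w :* z))
               refl (intK a) (intK b) x (eval p x) (eval q x) ⟩
    (intK a + x * eval p x) + (intK b + x * eval q x) ∎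

  eval-scale : ∀ a p x → eval (scale a p) x ≈ intK a * eval p x
  eval-scale a []      x = sym (zeroʳ _)
  eval-scale a (b ∷ p) x = begin
    intK (a ℤ.* b) + x * eval (scale a p) x          ≈⟨ +-cong (intK-* a b) (*-congˡ (eval-scale a p x)) ⟩
    intK a * intK b + x * (intK a * eval p x)
      ≈⟨ solve 4 (λ u v w y → u :* v :+ w :* (u :* y) := u :* (v :+ w :* y)) refl (intK a) (intK b) x (eval p x) ⟩
    intK a * (intK b + x * eval p x)                 ∎

  eval-⊛ : ∀ p q x → eval (p ⊛ q) x ≈ eval p x * eval q x
  eval-⊛ []      q x = sym (zeroˡ _)
  eval-⊛ (a ∷ p) q x = begin
    eval (scale a q ⊕ (ℤ.0ℤ ∷ (p ⊛ q))) x                 ≈⟨ eval-⊕ (scale a q) _ x ⟩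
    eval (scale a q) x + (0# + x * eval (p ⊛ q) x)
      ≈⟨ +-cong (eval-scale a q x) (+-congˡ (*-congˡ (eval-⊛ p q x))) ⟩
    intK a * eval q x + (0# + x * (eval p x * eval q x))
      ≈⟨ solve 4 (λ u v w y → u :* v :+ (con ℤ.0ℤ :+ w :* (y :* v)) := (u :+ w :* y) :* v)
               refl (intK a) (eval q x) x (eval p x) ⟩
    (intK a + x * eval p x) * eval q x                     ∎

  eval-constant : ∀ a x → eval (a ∷ []) x ≈ intK a
  eval-constant a x = solve 2 (λ a x → a :+ x :* con ℤ.0ℤ := a) refl (intK a) x

  eval-compose : ∀ g q x → eval (compose g q) x ≈ eval g (eval q x)
  eval-compose []      q x = refl
  eval-compose (a ∷ g) q x = begin
    eval ((a ∷ []) ⊕ (q ⊛ compose g q)) x         ≈⟨ eval-⊕ (a ∷ []) (q ⊛ compose g q) x ⟩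
    eval (a ∷ []) x + eval (q ⊛ compose g q) x     ≈⟨ +-cong (eval-constant a x) (eval-⊛ q (compose g q) x) ⟩
    intK a + eval q x * eval (compose g q) x       ≈⟨ +-congˡ (*-congˡ (eval-compose g q x)) ⟩
    intK a + eval q x * eval g (eval q x)          ∎

  eval-X : ∀ x → eval X x ≈ x
  eval-X x = solve 1 (λ x → con ℤ.0ℤ :+ x :* (con ℤ.1ℤ :+ x :* con ℤ.0ℤ) := x) refl x

  eval-X^ₚ : ∀ k x → eval (X ^ₚ k) x ≈ powK x k
  eval-X^ₚ zero    x = trans (eval-constant ℤ.1ℤ x) (+-identityʳ 1#)
  eval-X^ₚ (suc k) x = trans (eval-⊛ X (X ^ₚ k) x) (*-cong (eval-X x) (eval-X^ₚ k x))

  eval-arg : ∀ p {x x′} → x ≈ x′ → eval p x ≈ eval p x′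
  eval-arg []      x≈x′ = refl
  eval-arg (a ∷ p) x≈x′ = +-congˡ (*-cong x≈x′ (eval-arg p x≈x′))

  vanishing-remainder : ∀ {R T Q U} x → R ≋ (T ⊛ Q) ⊕ U → eval T x ≈ 0# → eval R x ≈ 0# → eval U x ≈ 0#
  vanishing-remainder {R} {T} {Q} {U} x R≋TQ+U Tx≈0 Rx≈0 = begin
    eval U x
      ≈⟨ solve 2 (λ u v → v := (u :+ v) :- u) refl (eval T x * eval Q x) (eval U x) ⟩
    (eval T x * eval Q x + eval U x) - eval T x * eval Q x
      ≈⟨ +-cong (sym (trans (eval-cong x R≋TQ+U) (trans (eval-⊕ (T ⊛ Q) U x) (+-congʳ (eval-⊛ T Q x)))))
                (-‿cong (*-congʳ Tx≈0)) ⟩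
    eval R x - 0# * eval Q x                         ≈⟨ +-congʳ Rx≈0 ⟩
    0# - 0# * eval Q x
      ≈⟨ solve 1 (λ q → con ℤ.0ℤ :- con ℤ.0ℤ :* q := con ℤ.0ℤ) refl (eval Q x) ⟩
    0#                                               ∎

  eval-∷ʳ : ∀ p a x → eval (p ∷ʳ a) x ≈ eval p x + powK x (length p) * intK a
  eval-∷ʳ []      a x = trans (eval-constant a x) (sym (trans (+-identityˡ _) (*-identityˡ _)))
  eval-∷ʳ (b ∷ p) a x = begin
    intK b + x * eval (p ∷ʳ a) x                                ≈⟨ +-congˡ (*-congˡ (eval-∷ʳ p a x)) ⟩
    intK b + x * (eval p x + powK x (length p) * intK a)
      ≈⟨ solve 5 (λ b x e w a → b :+ x :* (e :+ w :* a) := (b :+ x :* e) :+ (x :* w) :* a)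
               refl (intK b) x (eval p x) (powK x (length p)) (intK a) ⟩
    (intK b + x * eval p x) + (x * powK x (length p)) * intK a   ∎

  eval-reverse : ∀ {ε y} → ε * y ≈ 1# → ∀ H → powK ε (length H) * eval H y ≈ ε * eval (reverse H) ε
  eval-reverse {ε} {y} εy≈1 []      = trans (zeroʳ 1#) (sym (zeroʳ ε))
  eval-reverse {ε} {y} εy≈1 (a ∷ H) = begin
    (ε * εⁿ) * (intK a + y * h)
      ≈⟨ solve 5 (λ ε εⁿ a y h → (ε :* εⁿ) :* (a :+ y :* h) := ε :* εⁿ :* a :+ (εⁿ :* h) :* (ε :* y))
               refl ε εⁿ (intK a) y h ⟩
    ε * εⁿ * intK a + (εⁿ * h) * (ε * y)         ≈⟨ +-congˡ (trans (*-congˡ εy≈1) (*-identityʳ _)) ⟩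
    ε * εⁿ * intK a + εⁿ * h                     ≈⟨ +-congˡ (eval-reverse εy≈1 H) ⟩
    ε * εⁿ * intK a + ε * ρ
      ≈⟨ solve 4 (λ ε εⁿ a ρ → ε :* εⁿ :* a :+ ε :* ρ := ε :* (ρ :+ εⁿ :* a)) refl ε εⁿ (intK a) ρ ⟩
    ε * (ρ + εⁿ * intK a)
      ≡⟨ ≡.cong (λ n → ε * (ρ + powK ε n * intK a)) (ListP.length-reverse H) ⟨
    ε * (ρ + powK ε (length (reverse H)) * intK a)  ≈⟨ *-congˡ (eval-∷ʳ (reverse H) a ε) ⟨
    ε * eval (reverse H ∷ʳ a) ε                     ≡⟨ ≡.cong (λ r → ε * eval r ε) (ListP.unfold-reverse a H) ⟨
    ε * eval (reverse (a ∷ H)) ε                    ∎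
    where
    εⁿ : Carrier
    εⁿ = powK ε (length H)
    h : Carrier
    h = eval H y
    ρ : Carrier
    ρ = eval (reverse H) ε

  reverse-root : ∀ {ε y} → ε * y ≈ 1# → ∀ H → eval H y ≈ 0# → eval (reverse H) ε ≈ 0#
  reverse-root {ε} {y} εy≈1 H Hy≈0 = begin
    eval (reverse H) ε                  ≈⟨ *-identityˡ _ ⟨
    1# * eval (reverse H) ε             ≈⟨ *-congʳ (trans (*-comm y ε) εy≈1) ⟨
    (y * ε) * eval (reverse H) ε        ≈⟨ *-assoc y ε _ ⟩
    y * (ε * eval (reverse H) ε)        ≈⟨ *-congˡ (eval-reverse εy≈1 H) ⟨
    y * (εⁿ * eval H y)                 ≈⟨ *-congˡ (*-congˡ Hy≈0) ⟩
    y * (εⁿ * 0#)                       ≈⟨ solve 2 (λ y w → y :* (w :* con ℤ.0ℤ) := con ℤ.0ℤ)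
                                                    refl y εⁿ ⟩
    0#                                  ∎
    where
    εⁿ : Carrier
    εⁿ = powK ε (length H)

  -- Reversing a monic annihilator of ε⁻¹ gives an annihilator of ε with constant term 1.
  unit-annihilator : ∀ {ε} → IsUnit ε → Σ ℤX.Poly λ r → eval (ℤ.1ℤ ∷ r) ε ≈ 0#
  unit-annihilator {ε} (_ , y , εy≈1 , H , H-monic , Hy≈0) =
    r , ≡.subst (λ R → eval R ε ≈ 0#) (≡.trans rev≡lead∷r (≡.cong (_∷ r) H-monic))
                (reverse-root εy≈1 (ℤX.strip H) (trans (eval-cong y (ℤ[X].strip-≋ H)) Hy≈0))
    where
    lead≢0 : ℤX.lead H ≢ ℤ.0ℤ
    lead≢0 lead≡0 = case ≡.trans (≡.sym H-monic) lead≡0 of λ ()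
    r : ℤX.Poly
    r = proj₁ (ℤ[X].reverse-strip H lead≢0)
    rev≡lead∷r : reverse (ℤX.strip H) ≡ ℤX.lead H ∷ r
    rev≡lead∷r = proj₂ (ℤ[X].reverse-strip H lead≢0)

private
  1-coprime : ∀ n → Coprime n 1
  1-coprime n = Coprimality.sym (Coprimality.1-coprimeTo n)

  toℚ≡mkℚ : ∀ z → toℚ z ≡ mkℚ z 0 (1-coprime ℤ.∣ z ∣)
  toℚ≡mkℚ (ℤ.+ n)      = ℚP.normalize-coprime (1-coprime n)
  toℚ≡mkℚ ℤ.-[1+ n ]   = ≡.cong ℚ.-_ (ℚP.normalize-coprime (1-coprime (suc n)))

toℚ-0 : toℚ ℤ.0ℤ ≡ 0ℚ
toℚ-0 = toℚ≡mkℚ ℤ.0ℤ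

toℚ-1 : toℚ ℤ.1ℤ ≡ 1ℚ
toℚ-1 = toℚ≡mkℚ ℤ.1ℤ

toℚ-+ : ∀ a b → toℚ (a ℤ.+ b) ≡ toℚ a ℚ.+ toℚ b
toℚ-+ a b = ≡.sym (≡.trans (≡.cong₂ ℚ._+_ (toℚ≡mkℚ a) (toℚ≡mkℚ b))
                           (≡.cong (ℚ._/ 1) (≡.cong₂ ℤ._+_ (ℤP.*-identityʳ a) (ℤP.*-identityʳ b))))

toℚ-* : ∀ a b → toℚ (a ℤ.* b) ≡ toℚ a ℚ.* toℚ b
toℚ-* a b = ≡.sym (≡.cong₂ ℚ._*_ (toℚ≡mkℚ a) (toℚ≡mkℚ b))

toℚ≡0⇒≡0 : ∀ {z} → toℚ z ≡ 0ℚ → z ≡ ℤ.0ℤ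
toℚ≡0⇒≡0 {z} z≡0 = ≡.trans (≡.sym (≡.cong ℚ.↥_ (toℚ≡mkℚ z))) (≡.cong ℚ.↥_ z≡0)

module ℤ[X]→ℚ[X] = PolynomialMap ℤ-coefficients ℚ-coefficients toℚ toℚ-0 toℚ-1 toℚ-+ toℚ-*

module MinimalPolynomial {c ℓ} (K : CommutativeRing c ℓ)
  (char-0 : ∀ n → CommutativeRing._≈_ K (InRing.natK K n) (CommutativeRing.0# K) → n ≡ 0)
  {ε : CommutativeRing.Carrier K} {F : ℤX.Poly} (F-monic : ℤX.Monic F) (F-irreducible : IrreducibleOverℚ F)
  (F-root : CommutativeRing._≈_ K (InRing.eval K F ε) (CommutativeRing.0# K)) where

  open CommutativeRing K
  open InRing K using (eval; intK)
  open Evaluation K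
  open IntegerEmbedding K using (intK≈0⇒≡0)
  open ℤ[X]

  N : ℕ
  N = deg F

  ^ᶜ-≢0 : ∀ {a} e → a ≢ ℤ.0ℤ → a ^ᶜ e ≢ ℤ.0ℤ
  ^ᶜ-≢0 zero    _   ()
  ^ᶜ-≢0 (suc e) a≢0 aᵉ⁺¹≡0 with ℤP.i*j≡0⇒i≡0∨j≡0 _ aᵉ⁺¹≡0
  ... | inj₁ a≡0  = a≢0 a≡0
  ... | inj₂ aᵉ≡0 = ^ᶜ-≢0 e a≢0 aᵉ≡0

  F[N]≡1 : coeff F N ≡ ℤ.1ℤ
  F[N]≡1 = ≡.trans (≡.sym (lead≡coeff-deg F)) F-monic

  no-proper-factor : ∀ {U Q d} a → a ≢ ℤ.0ℤ → scale a F ≋ (U ⊛ Q) →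
                     DegreeBelow U (suc (suc d)) → coeff U (suc d) ≢ ℤ.0ℤ → suc d < N → ⊥
  no-proper-factor {U} {Q} {d} a a≢0 aF≋UQ U<2+d U[1+d]≢0 1+d<N =
    [ degU′≢0 , degh≢0 ]′ (proj₂ F-irreducible U′ h (ℚ[X].at U′h≋F′))
    where
    k : ℚ
    k = toℚ a
    instance
      k≢0 : ℚ.NonZero k
      k≢0 = ℚ.≢-nonZero (λ k≡0 → a≢0 (toℚ≡0⇒≡0 k≡0))
    F′ : ℚX.Poly
    F′ = map toℚ F
    U′ : ℚX.Poly
    U′ = map toℚ U
    h : ℚX.Poly
    h = ℚ[X].scale (ℚ.1/ k) (map toℚ Q)

    U′h≋F′ : (U′ ℚ[X].⊛ h) ℚ[X].≋ F′
    U′h≋F′ = begin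
      U′ ℚ[X].⊛ h                               ≈⟨ ℚ[X].scale-⊛ʳ (ℚ.1/ k) U′ (map toℚ Q) ⟨
      ℚ[X].scale (ℚ.1/ k) (U′ ℚ[X].⊛ map toℚ Q)
        ≈⟨ scale⁻¹-cong (ℚ[X].≋-reflexive (ℤ[X]→ℚ[X].map-⊛ U Q)) ⟨
      ℚ[X].scale (ℚ.1/ k) (map toℚ (U ⊛ Q))      ≈⟨ scale⁻¹-cong (ℤ[X]→ℚ[X].map-cong aF≋UQ) ⟨
      ℚ[X].scale (ℚ.1/ k) (map toℚ (scale a F))
        ≡⟨ ≡.cong (ℚ[X].scale (ℚ.1/ k)) (ℤ[X]→ℚ[X].map-scale a F) ⟩
      ℚ[X].scale (ℚ.1/ k) (ℚ[X].scale k F′)      ≈⟨ ℚ[X].scale-assoc (ℚ.1/ k) k F′ ⟩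
      ℚ[X].scale (ℚ.1/ k ℚ.* k) F′               ≈⟨ ℚ[X].scale-cong (ℚP.*-inverseˡ k) ℚ[X].≋-refl ⟩
      ℚ[X].scale 1ℚ F′                            ≈⟨ ℚ[X].scale-identity F′ ⟩
      F′                                          ∎
      where
      open ℚ[X].≋-Reasoning
      scale⁻¹-cong : ∀ {p q} → p ℚ[X].≋ q → ℚ[X].scale (ℚ.1/ k) p ℚ[X].≋ ℚ[X].scale (ℚ.1/ k) q
      scale⁻¹-cong = ℚ[X].scale-cong {ℚ.1/ k} ≡.refl

    U′<2+d : ℚ[X].DegreeBelow U′ (suc (suc d))
    U′<2+d = ℤ[X]→ℚ[X].map-DegreeBelow U<2+d

    degU′≢0 : ℚ[X].deg U′ ≢ 0
    degU′≢0 degU′≡0 = case ≡.trans (≡.sym degU′≡1+d) degU′≡0 of λ ()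
      where
      degU′≡1+d : ℚ[X].deg U′ ≡ suc d
      degU′≡1+d = ℚ[X].deg-exact U′<2+d λ U′[1+d]≡0 →
        U[1+d]≢0 (toℚ≡0⇒≡0 (≡.trans (≡.sym (ℤ[X]→ℚ[X].coeff-map U (suc d))) U′[1+d]≡0))

    degh≢0 : ℚ[X].deg h ≢ 0
    degh≢0 degh≡0 = case ≡.trans (≡.sym F′[N]≡1) (ℚ[X].vanishes F′<2+d N 2+d≤N) of λ ()
      where
      2+d≤N : suc (suc d ℕ.+ 0) ≤ N
      2+d≤N = ≡.subst (λ m → suc m ≤ N) (≡.sym (ℕP.+-identityʳ (suc d))) 1+d<N
      F′<2+d : ℚ[X].DegreeBelow F′ (suc (suc d ℕ.+ 0))
      F′<2+d = ℚ[X].DegreeBelow-resp U′h≋F′ (proj₁ (ℚ[X].⊛-leading U′ h (suc d) 0 U′<2+d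
                 (≡.subst (λ m → ℚ[X].DegreeBelow h (suc m)) degh≡0 (ℚ[X].deg-bound h))))
      F′[N]≡1 : ℚ[X].coeff F′ N ≡ 1ℚ
      F′[N]≡1 = ≡.trans (ℤ[X]→ℚ[X].coeff-map F N) (≡.trans (≡.cong toℚ F[N]≡1) toℚ-1)

  -- Pseudo-dividing F by U leaves a remainder of smaller degree vanishing at ε, hence zero;
  -- the resulting factorisation of a multiple of F contradicts irreducibility over ℚ.
  no-root-of-degree : ∀ d {U} → d < N → DegreeBelow U (suc d) → coeff U d ≢ ℤ.0ℤ → eval U ε ≈ 0# →
                      (∀ {V} → DegreeBelow V d → eval V ε ≈ 0# → V ≋ []) → ⊥
  no-root-of-degree zero     {U} _      U<1    U[0]≢0 Uε≈0 _ = U[0]≢0 (intK≈0⇒≡0 char-0 (begin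
    intK (coeff U 0)             ≈⟨ eval-constant (coeff U 0) ε ⟨
    eval (coeff U 0 ∷ []) ε      ≈⟨ eval-cong ε (DegreeBelow-one U<1) ⟨
    eval U ε                     ≈⟨ Uε≈0 ⟩
    0#                           ∎))
    where open SetoidReasoning setoid
  no-root-of-degree (suc d) {U} 1+d<N U<2+d U[1+d]≢0 Uε≈0 smaller-roots-vanish
    with pseudoDivide U<2+d (suc N) F (deg-bound F)
  ... | pseudoDivision e Q V cᵉF≋UQ+V V<1+d =
    no-proper-factor cᵉ (^ᶜ-≢0 e U[1+d]≢0) cᵉF≋UQ U<2+d U[1+d]≢0 1+d<N
    where
    cᵉ : ℤ
    cᵉ = coeff U (suc d) ^ᶜ e
    cᵉFε≈0 : eval (scale cᵉ F) ε ≈ 0#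
    cᵉFε≈0 = trans (eval-scale cᵉ F ε) (trans (*-congˡ F-root) (zeroʳ _))
    V≋[] : V ≋ []
    V≋[] = smaller-roots-vanish V<1+d (vanishing-remainder {T = U} {Q} {V} ε cᵉF≋UQ+V Uε≈0 cᵉFε≈0)
    cᵉF≋UQ : scale cᵉ F ≋ (U ⊛ Q)
    cᵉF≋UQ = ≋-trans cᵉF≋UQ+V (≋-trans (⊕-cong (≋-refl {U ⊛ Q}) V≋[]) (⊕-identityʳ (U ⊛ Q)))

  no-smaller-root : ∀ d → d ≤ N → ∀ {U} → DegreeBelow U d → eval U ε ≈ 0# → U ≋ []
  no-smaller-root zero    _         U<0   _    = DegreeBelow-zero U<0
  no-smaller-root (suc d) 1+d≤N {U} U<1+d Uε≈0 with coeff U d ℤ.≟ ℤ.0ℤ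
  ... | yes U[d]≡0 = no-smaller-root d (ℕP.<⇒≤ 1+d≤N) (DegreeBelow-pred U<1+d U[d]≡0) Uε≈0
  ... | no  U[d]≢0 =
    ⊥-elim (no-root-of-degree d 1+d≤N U<1+d U[d]≢0 Uε≈0 (no-smaller-root d (ℕP.<⇒≤ 1+d≤N)))

  minimalPolynomial-∣ : ∀ R → eval R ε ≈ 0# → F ∣ R
  minimalPolynomial-∣ R Rε≈0 with divideMonic (deg-bound F) F[N]≡1 R
  ... | division Q U R≋FQ+U U<N = Q , ≋-trans (⊛-comm Q F) (≋-sym R≋FQ)
    where
    U≋[] : U ≋ []
    U≋[] = no-smaller-root N ℕP.≤-refl U<N (vanishing-remainder {T = F} {Q} {U} ε R≋FQ+U F-root Rε≈0)
    R≋FQ : R ≋ (F ⊛ Q)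
    R≋FQ = ≋-trans R≋FQ+U (≋-trans (⊕-cong (≋-refl {F ⊛ Q}) U≋[]) (⊕-identityʳ (F ⊛ Q)))

module Parity where

  private
    𝔽₂ : CommutativeRing 0ℓ 0ℓ
    𝔽₂ = CoefficientRing.commutativeRing 𝔽₂-coefficients
    open ≡ using (refl; sym; trans; cong; cong₂)
  open InRing 𝔽₂ using (natK; intK)
  open IntegerEmbedding 𝔽₂ using (natK-+; intK-+; intK-*)

  natK≡%2 : ∀ n → natK n ≡ (n % 2 ≡ᵇ 1)
  natK≡%2 zero          = refl
  natK≡%2 (suc zero)    = refl
  natK≡%2 (suc (suc n)) = begin
    not (not (natK n))          ≡⟨ BoolP.not-involutive (natK n) ⟩
    natK n                      ≡⟨ natK≡%2 n ⟩
    (n % 2 ≡ᵇ 1)                ≡⟨ cong (_≡ᵇ 1) ([m+n]%n≡m%n n 2) ⟨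
    ((n ℕ.+ 2) % 2 ≡ᵇ 1)        ≡⟨ cong (λ m → m % 2 ≡ᵇ 1) (ℕP.+-comm n 2) ⟩
    (suc (suc n) % 2 ≡ᵇ 1)      ∎
    where open ≡.≡-Reasoning

  red₂≡intK : ∀ z → red₂ z ≡ intK z
  red₂≡intK (ℤ.+ n)      = sym (natK≡%2 n)
  red₂≡intK ℤ.-[1+ n ]   = sym (natK≡%2 (suc n))

  red₂-+ : ∀ a b → red₂ (a ℤ.+ b) ≡ red₂ a xor red₂ b
  red₂-+ a b =
    trans (red₂≡intK (a ℤ.+ b)) (trans (intK-+ a b) (sym (cong₂ _xor_ (red₂≡intK a) (red₂≡intK b))))

  red₂-* : ∀ a b → red₂ (a ℤ.* b) ≡ red₂ a ∧ red₂ b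
  red₂-* a b =
    trans (red₂≡intK (a ℤ.* b)) (trans (intK-* a b) (sym (cong₂ _∧_ (red₂≡intK a) (red₂≡intK b))))

  natK-L : ∀ G → natK (L G) ≡ foldr _xor_ false (φ G)
  natK-L []      = refl
  natK-L (b ∷ G) = trans (natK-+ ℤ.∣ b ∣ (L G)) (cong₂ _xor_ (natK≡%2 ℤ.∣ b ∣) (natK-L G))

  natK≡false⇒even : ∀ n → natK n ≡ false → 2 ∣ℕ n
  natK≡false⇒even zero          _ = divides 0 refl
  natK≡false⇒even (suc (suc n)) 2+n≡false
    with natK≡false⇒even n (trans (sym (BoolP.not-involutive (natK n))) 2+n≡false)
  ... | divides q n≡q*2 = divides (suc q) (cong (λ m → suc (suc m)) n≡q*2)

module ℤ[X]→𝔽₂[X] =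
  PolynomialMap ℤ-coefficients 𝔽₂-coefficients red₂ ≡.refl ≡.refl Parity.red₂-+ Parity.red₂-*

module IrreducibleOver𝔽₂ {P : 𝔽₂[X].Poly} (P-irreducible : 𝔽₂X.Irreducible P) where

  open 𝔽₂[X]
  open IntegerEmbedding.Solver polynomialRing using (solve; _:+_; _:-_; _:*_; _:=_)
  open ≡ using (refl; sym; trans; cong; cong₂; subst)

  n : ℕ
  n = deg P

  nonzero⇒true : ∀ {b} → b ≢ false → b ≡ true
  nonzero⇒true = BoolP.¬-not

  P[n]≡true : coeff P n ≡ true
  P[n]≡true with ≋[]⊎coeff-deg≢0 P
  ... | inj₁ P≋[]   = case subst (1 ≤_) (≋[]⇒deg≡0 P≋[]) (proj₁ P-irreducible) of λ ()
  ... | inj₂ P[n]≢0 = nonzero⇒true P[n]≢0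

  P≢0 : ¬ P ≋ []
  P≢0 P≋[] = case trans (sym P[n]≡true) (at P≋[] n) of λ ()

  ∣-DegreeBelow⇒≋[] : ∀ {u} → P ∣ u → DegreeBelow u n → u ≋ []
  ∣-DegreeBelow⇒≋[] {u} (q , qP≋u) u<n with ≋[]⊎coeff-deg≢0 q
  ... | inj₁ q≋[]    = ≋-trans (≋-sym qP≋u) (⊛-≋[]ˡ P q≋[])
  ... | inj₂ q[e]≢0 = case trans (sym u[e+n]≡true) (vanishes u<n (deg q ℕ.+ n) (ℕP.m≤n+m n (deg q))) of λ ()
    where
    u[e+n]≡true : coeff u (deg q ℕ.+ n) ≡ true
    u[e+n]≡true = begin
      coeff u (deg q ℕ.+ n)           ≡⟨ at qP≋u _ ⟨
      coeff (q ⊛ P) (deg q ℕ.+ n)     ≡⟨ proj₂ (⊛-leading q P (deg q) n (deg-bound q) (deg-bound P)) ⟩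
      coeff q (deg q) ∧ coeff P n     ≡⟨ cong₂ _∧_ (nonzero⇒true q[e]≢0) P[n]≡true ⟩
      true                            ∎
      where open ≡.≡-Reasoning

  P∤one : ¬ P ∣ one
  P∤one P∣one = case at (∣-DegreeBelow⇒≋[] P∣one one<n) 0 of λ ()
    where
    one<n : DegreeBelow one n
    one<n = DegreeBelow-mono (proj₁ P-irreducible) (DegreeBelow-length one)

  private
    degree-zero⇒one : ∀ {c} → deg c ≡ 0 → ¬ c ≋ [] → c ≋ one
    degree-zero⇒one {c} deg≡0 c≢0 with coeff c 0 BoolP.≟ false
    ... | yes c₀≡0 = ⊥-elim (c≢0 (≋-trans (deg≡0⇒constant deg≡0) (∷≋[]⁺ c₀≡0 ≋-refl)))
    ... | no  c₀≢0 = ≋-trans (deg≡0⇒constant deg≡0) (∷-cong (nonzero⇒true c₀≢0) ≋-refl)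

  ∣P⇒≋one⊎≋P : ∀ {b} → b ∣ P → b ≋ one ⊎ b ≋ P
  ∣P⇒≋one⊎≋P {b} (q , qb≋P) with proj₂ P-irreducible q b (at qb≋P)
  ... | inj₁ degq≡0 = inj₂ (begin
    b          ≈⟨ ⊛-identityˡ b ⟨
    one ⊛ b    ≈⟨ ⊛-congˡ b (degree-zero⇒one {q} degq≡0 q≢0) ⟨
    q ⊛ b      ≈⟨ qb≋P ⟩
    P          ∎)
    where
    open ≋-Reasoning
    q≢0 : ¬ q ≋ []
    q≢0 q≋[] = P≢0 (≋-trans (≋-sym qb≋P) (⊛-≋[]ˡ b q≋[]))
  ... | inj₂ degb≡0 = inj₁ (degree-zero⇒one {b} degb≡0 λ b≋[] →
    P≢0 (≋-trans (≋-sym qb≋P) (≋-trans (⊛-congʳ q b≋[]) (⊛-zeroʳ q))))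

  ∣-constant⇒≡false : ∀ {c} → P ∣ (c ∷ []) → c ≡ false
  ∣-constant⇒≡false {false} _    = refl
  ∣-constant⇒≡false {true}  P∣1 = ⊥-elim (P∤one P∣1)

  ∣-1∷⇒∤X : ∀ {r} → P ∣ (true ∷ r) → ¬ P ∣ X
  ∣-1∷⇒∤X {r} P∣1∷r P∣X =
    P∤one (∣ʳ-respʳ-≈ 1∷r-r⊛X≋1 (∣-+ P∣1∷r (∣-neg (x∣ʳy⇒x∣ʳzy r P∣X))))
    where
    1∷r-r⊛X≋1 : (true ∷ r) ⊖ (r ⊛ X) ≋ one
    1∷r-r⊛X≋1 = begin
      (true ∷ r) ⊖ (r ⊛ X)              ≈⟨ ⊕-cong (∷≋const⊕X⊛ true r) ≋-refl ⟩
      (one ⊕ (X ⊛ r)) ⊖ (r ⊛ X)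
        ≈⟨ solve 3 (λ o x r → (o :+ x :* r) :- r :* x := o) ≋-refl one X r ⟩
      one                               ∎
      where open ≋-Reasoning

  record InIdeal (a b : Poly) : Set where
    constructor combination
    field
      s t      : Poly
      equation : (s ⊛ P) ⊕ (t ⊛ a) ≋ b

  module _ {a : Poly} where

    InIdeal-resp : ∀ {b c} → b ≋ c → InIdeal a b → InIdeal a c
    InIdeal-resp b≋c (combination s t eq) = combination s t (≋-trans eq b≋c)

    InIdeal-P : InIdeal a P
    InIdeal-P = combination one [] (≋-trans (⊕-identityʳ (one ⊛ P)) (⊛-identityˡ P))

    InIdeal-a : InIdeal a a
    InIdeal-a = combination [] one (⊛-identityˡ a)

    InIdeal-⊖ : ∀ {b c} → InIdeal a b → InIdeal a c → InIdeal a (b ⊖ c)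
    InIdeal-⊖ {b} {c} (combination s t eq) (combination s′ t′ eq′) =
      combination (s ⊖ s′) (t ⊖ t′) (begin
        ((s ⊖ s′) ⊛ P) ⊕ ((t ⊖ t′) ⊛ a)
          ≈⟨ solve 6 (λ s s′ t t′ p a → (s :- s′) :* p :+ (t :- t′) :* a
                                        := (s :* p :+ t :* a) :- (s′ :* p :+ t′ :* a))
                   ≋-refl s s′ t t′ P a ⟩
        ((s ⊛ P) ⊕ (t ⊛ a)) ⊖ ((s′ ⊛ P) ⊕ (t′ ⊛ a))   ≈⟨ ⊕-cong eq (neg-cong eq′) ⟩
        b ⊖ c                                         ∎)
      where open ≋-Reasoning

    InIdeal-⊛ : ∀ {b} c → InIdeal a b → InIdeal a (c ⊛ b)
    InIdeal-⊛ {b} c (combination s t eq) = combination (c ⊛ s) (c ⊛ t) (begin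
      ((c ⊛ s) ⊛ P) ⊕ ((c ⊛ t) ⊛ a)
        ≈⟨ solve 5 (λ c s t p a → c :* s :* p :+ c :* t :* a := c :* (s :* p :+ t :* a)) ≋-refl c s t P a ⟩
      c ⊛ ((s ⊛ P) ⊕ (t ⊛ a))         ≈⟨ ⊛-congʳ c eq ⟩
      c ⊛ b                           ∎)
      where open ≋-Reasoning

    reduce-modulo : ∀ {b d} → InIdeal a b → DegreeBelow b (suc d) → coeff b d ≡ true →
                    ∀ {x} → InIdeal a x → b ∣ x ⊎ Σ Poly λ r → InIdeal a r × DegreeBelow r d × ¬ r ≋ []
    reduce-modulo {b} b∈I b<1+d b[d]≡true {x} x∈I with divideMonic b<1+d b[d]≡true x
    ... | division q r x≋bq+r r<d with ≋[]⊎coeff-deg≢0 r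
    ...   | inj₁ r≋[]       = inj₁ (q , (begin
      q ⊛ b               ≈⟨ ⊛-comm q b ⟩
      b ⊛ q               ≈⟨ ⊕-identityʳ (b ⊛ q) ⟨
      (b ⊛ q) ⊕ []        ≈⟨ ⊕-cong (≋-refl {b ⊛ q}) r≋[] ⟨
      (b ⊛ q) ⊕ r         ≈⟨ x≋bq+r ⟨
      x                   ∎))
      where open ≋-Reasoning
    ...   | inj₂ r[deg]≢0 = inj₂ (r , InIdeal-resp x-qb≋r (InIdeal-⊖ x∈I (InIdeal-⊛ q b∈I)) , r<d ,
                                  λ r≋[] → r[deg]≢0 (at r≋[] (deg r)))
      where
      x-qb≋r : x ⊖ (q ⊛ b) ≋ r
      x-qb≋r = begin
        x ⊖ (q ⊛ b)                 ≈⟨ ⊕-cong x≋bq+r ≋-refl ⟩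
        ((b ⊛ q) ⊕ r) ⊖ (q ⊛ b)     ≈⟨ solve 3 (λ b q r → (b :* q :+ r) :- q :* b := r) ≋-refl b q r ⟩
        r                           ∎
        where open ≋-Reasoning

    -- A nonzero element of least degree in the ideal (P, a) divides P and a, so it is one or P.
    ideal-descent : ∀ d {b} → DegreeBelow b d → InIdeal a b → ¬ b ≋ [] → InIdeal a one ⊎ P ∣ a
    ideal-descent zero    b<0   _   b≢0 = ⊥-elim (b≢0 (DegreeBelow-zero b<0))
    ideal-descent (suc d) {b} b<1+d b∈I b≢0 with coeff b d BoolP.≟ false
    ... | yes b[d]≡0 = ideal-descent d (DegreeBelow-pred b<1+d b[d]≡0) b∈I b≢0
    ... | no  b[d]≢0 with reduce-modulo b∈I b<1+d (nonzero⇒true b[d]≢0) InIdeal-P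
                        | reduce-modulo b∈I b<1+d (nonzero⇒true b[d]≢0) InIdeal-a
    ...   | inj₂ (r , r∈I , r<d , r≢0) | _                            = ideal-descent d r<d r∈I r≢0
    ...   | inj₁ _                     | inj₂ (r , r∈I , r<d , r≢0) = ideal-descent d r<d r∈I r≢0
    ...   | inj₁ b∣P                   | inj₁ b∣a                     =
      [ (λ b≋one → inj₁ (InIdeal-resp b≋one b∈I)) , (λ b≋P → inj₂ (∣ʳ-respˡ-≈ b≋P b∣a)) ]′
        (∣P⇒≋one⊎≋P b∣P)

  bezout : ∀ {a} → ¬ P ∣ a → InIdeal a one
  bezout {a} P∤a with ≋[]⊎coeff-deg≢0 a
  ... | inj₁ a≋[]     = ⊥-elim (P∤a (∣ʳ-respʳ-≈ (≋-sym a≋[]) (P ∣0)))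
  ... | inj₂ a[deg]≢0 = [ id , ⊥-elim ∘ P∤a ]′
    (ideal-descent (length a) (DegreeBelow-length a) InIdeal-a (λ a≋[] → a[deg]≢0 (at a≋[] (deg a))))

  euclid : ∀ {a b} → ¬ P ∣ a → P ∣ (a ⊛ b) → P ∣ b
  euclid {a} {b} P∤a P∣ab with bezout P∤a
  ... | combination s t sP+ta≋1 =
    ∣ʳ-respʳ-≈ combination≋b (∣-+ (x∣ʳyx P (s ⊛ b)) (x∣ʳy⇒x∣ʳzy t P∣ab))
    where
    combination≋b : ((s ⊛ b) ⊛ P) ⊕ (t ⊛ (a ⊛ b)) ≋ b
    combination≋b = begin
      ((s ⊛ b) ⊛ P) ⊕ (t ⊛ (a ⊛ b))
        ≈⟨ solve 5 (λ s b p t a → s :* b :* p :+ t :* (a :* b) := (s :* p :+ t :* a) :* b) ≋-refl s b P t a ⟩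
      ((s ⊛ P) ⊕ (t ⊛ a)) ⊛ b        ≈⟨ ⊛-congˡ b sP+ta≋1 ⟩
      one ⊛ b                         ≈⟨ ⊛-identityˡ b ⟩
      b                               ∎
      where open ≋-Reasoning

module _ {A : Set} where

  unique-⊆-length⇒↭ : ∀ (ys xs : List A) → Unique ys → (∀ {z} → z ∈ ys → z ∈ xs) →
                      length ys ≡ length xs → ys ↭ xs
  unique-⊆-length⇒↭ []       []  _                     _     _           = ↭-refl
  unique-⊆-length⇒↭ (y ∷ ys) xs (y∉ys AllPairs.∷ ys!) ys⊆xs |y∷ys|≡|xs|
    with ∈-∃++ (ys⊆xs (here ≡.refl))
  ... | as , bs , ≡.refl =
    ↭-trans (prep y (unique-⊆-length⇒↭ ys (as ++ bs) ys! ys⊆as++bs |ys|≡|as++bs|)) (↭-sym (↭-shift y as bs))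
    where
    ys⊆as++bs : ∀ {z} → z ∈ ys → z ∈ as ++ bs
    ys⊆as++bs z∈ys with ∈-++⁻ as (ys⊆xs (there z∈ys))
    ... | inj₁ z∈as          = ∈-++⁺ˡ z∈as
    ... | inj₂ (here ≡.refl) = ⊥-elim (All.lookup y∉ys z∈ys ≡.refl)
    ... | inj₂ (there z∈bs)  = ∈-++⁺ʳ as z∈bs
    |ys|≡|as++bs| : length ys ≡ length (as ++ bs)
    |ys|≡|as++bs| = ℕP.suc-injective (≡.trans |y∷ys|≡|xs| (ListP.length-++-sucʳ as y bs))

  map-unique : ∀ {B : Set} (f : A → B) {xs} → (∀ {u v} → u ∈ xs → v ∈ xs → f u ≡ f v → u ≡ v) →
               Unique xs → Unique (map f xs)
  map-unique f {[]}     _     _                    = AllPairs.[]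
  map-unique f {x ∷ xs} f-inj (x∉xs AllPairs.∷ xs!) =
    images-distinct xs id x∉xs AllPairs.∷ map-unique f (λ u∈xs v∈xs → f-inj (there u∈xs) (there v∈xs)) xs!
    where
    images-distinct : ∀ ys → (∀ {v} → v ∈ ys → v ∈ xs) → All.All (x ≢_) ys →
                      All.All (f x ≢_) (map f ys)
    images-distinct []       _     _                = All.[]
    images-distinct (y ∷ ys) ys⊆xs (x≢y All.∷ x∉ys) =
      (x≢y ∘ f-inj (here ≡.refl) (there (ys⊆xs (here ≡.refl))))
        All.∷ images-distinct ys (ys⊆xs ∘ there) x∉ys

bitStrings : ℕ → List (List Bool)
bitStrings zero    = [] ∷ []
bitStrings (suc k) = map (false ∷_) (bitStrings k) ++ map (true ∷_) (bitStrings k)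

nonzeroBitStrings : ℕ → List (List Bool)
nonzeroBitStrings zero    = []
nonzeroBitStrings (suc k) = map (false ∷_) (nonzeroBitStrings k) ++ map (true ∷_) (bitStrings k)

module _ where
  open 𝔽₂[X] using (_≋_; at; ∷≋[]⁻; ∷≋[]⁺)
  open ≡ using (refl; sym; trans; cong; cong₂)

  ∈-bitStrings : ∀ k u → length u ≡ k → u ∈ bitStrings k
  ∈-bitStrings zero    []          refl   = here refl
  ∈-bitStrings (suc k) (false ∷ u) |u|≡k =
    ∈-++⁺ˡ (∈-map⁺ (false ∷_) (∈-bitStrings k u (ℕP.suc-injective |u|≡k)))
  ∈-bitStrings (suc k) (true ∷ u)  |u|≡k =
    ∈-++⁺ʳ (map (false ∷_) (bitStrings k)) (∈-map⁺ (true ∷_) (∈-bitStrings k u (ℕP.suc-injective |u|≡k)))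

  ∈-nonzeroBitStrings : ∀ k u → length u ≡ k → ¬ u ≋ [] → u ∈ nonzeroBitStrings k
  ∈-nonzeroBitStrings zero    []          refl   u≢0 = ⊥-elim (u≢0 (𝔽₂[X].≋-refl))
  ∈-nonzeroBitStrings (suc k) (false ∷ u) |u|≡k u≢0 =
    ∈-++⁺ˡ (∈-map⁺ (false ∷_)
      (∈-nonzeroBitStrings k u (ℕP.suc-injective |u|≡k) (u≢0 ∘ ∷≋[]⁺ refl)))
  ∈-nonzeroBitStrings (suc k) (true ∷ u)  |u|≡k _   =
    ∈-++⁺ʳ (map (false ∷_) (nonzeroBitStrings k))
           (∈-map⁺ (true ∷_) (∈-bitStrings k u (ℕP.suc-injective |u|≡k)))

  bitStrings-length : ∀ k {u} → u ∈ bitStrings k → length u ≡ k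
  bitStrings-length zero    (here refl) = refl
  bitStrings-length (suc k) u∈ with ∈-++⁻ (map (false ∷_) (bitStrings k)) u∈
  ... | inj₁ u∈₀ with ∈-map⁻ (false ∷_) u∈₀
  ...   | _ , u′∈ , refl = cong suc (bitStrings-length k u′∈)
  bitStrings-length (suc k) u∈ | inj₂ u∈₁ with ∈-map⁻ (true ∷_) u∈₁
  ...   | _ , u′∈ , refl = cong suc (bitStrings-length k u′∈)

  nonzeroBitStrings-sound : ∀ k {u} → u ∈ nonzeroBitStrings k → length u ≡ k × ¬ u ≋ []
  nonzeroBitStrings-sound (suc k) u∈ with ∈-++⁻ (map (false ∷_) (nonzeroBitStrings k)) u∈
  ... | inj₁ u∈₀ with ∈-map⁻ (false ∷_) u∈₀
  ...   | _ , u′∈ , refl = cong suc (proj₁ (nonzeroBitStrings-sound k u′∈)) ,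
                           (proj₂ (nonzeroBitStrings-sound k u′∈) ∘ proj₂ ∘ ∷≋[]⁻)
  nonzeroBitStrings-sound (suc k) u∈ | inj₂ u∈₁ with ∈-map⁻ (true ∷_) u∈₁
  ...   | _ , u′∈ , refl = cong suc (bitStrings-length k u′∈) , (λ u≋[] → case at u≋[] 0 of λ ())

  private
    disjoint : ∀ xs ys {v} → ¬ (v ∈ map (false ∷_) xs × v ∈ map (true ∷_) ys)
    disjoint xs ys (v∈₀ , v∈₁) with ∈-map⁻ (false ∷_) v∈₀ | ∈-map⁻ (true ∷_) v∈₁
    ... | _ , _ , refl | _ , _ , ()

  unique-bitStrings : ∀ k → Unique (bitStrings k)
  unique-bitStrings zero    = All.[] AllPairs.∷ AllPairs.[]
  unique-bitStrings (suc k) = Unique.++⁺ (Unique.map⁺ ListP.∷-injectiveʳ (unique-bitStrings k))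
                                         (Unique.map⁺ ListP.∷-injectiveʳ (unique-bitStrings k))
                                         (disjoint (bitStrings k) (bitStrings k))

  unique-nonzeroBitStrings : ∀ k → Unique (nonzeroBitStrings k)
  unique-nonzeroBitStrings zero    = AllPairs.[]
  unique-nonzeroBitStrings (suc k) = Unique.++⁺ (Unique.map⁺ ListP.∷-injectiveʳ (unique-nonzeroBitStrings k))
                                                (Unique.map⁺ ListP.∷-injectiveʳ (unique-bitStrings k))
                                                (disjoint (nonzeroBitStrings k) (bitStrings k))

  private
    length-halves : ∀ xs ys → length (map (false ∷_) xs ++ map (true ∷_) ys) ≡ length xs ℕ.+ length ys
    length-halves xs ys = trans (ListP.length-++ (map (false ∷_) xs))
                                (cong₂ ℕ._+_ (ListP.length-map _ xs) (ListP.length-map _ ys))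

  length-bitStrings : ∀ k → length (bitStrings k) ≡ 2 ^ k
  length-bitStrings zero    = refl
  length-bitStrings (suc k) = begin
    length (bitStrings (suc k))                       ≡⟨ length-halves (bitStrings k) (bitStrings k) ⟩
    length (bitStrings k) ℕ.+ length (bitStrings k)
      ≡⟨ cong₂ ℕ._+_ (length-bitStrings k) (length-bitStrings k) ⟩
    2 ^ k ℕ.+ 2 ^ k                                   ≡⟨ cong (2 ^ k ℕ.+_) (ℕP.+-identityʳ (2 ^ k)) ⟨
    2 ^ suc k                                         ∎
    where open ≡.≡-Reasoning

  length-nonzeroBitStrings : ∀ k → length (nonzeroBitStrings k) ≡ 2 ^ k ∸ 1
  length-nonzeroBitStrings zero    = refl
  length-nonzeroBitStrings (suc k) = begin
    length (nonzeroBitStrings (suc k))                     ≡⟨ length-halves (nonzeroBitStrings k) (bitStrings k) ⟩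
    length (nonzeroBitStrings k) ℕ.+ length (bitStrings k) ≡⟨ cong₂ ℕ._+_ (length-nonzeroBitStrings k)
                                                                           (length-bitStrings k) ⟩
    (2 ^ k ∸ 1) ℕ.+ 2 ^ k                                  ≡⟨ ℕP.+-∸-comm (2 ^ k) (ℕP.m^n>0 2 k) ⟨
    (2 ^ k ℕ.+ 2 ^ k) ∸ 1
      ≡⟨ cong (λ m → (2 ^ k ℕ.+ m) ∸ 1) (ℕP.+-identityʳ (2 ^ k)) ⟨
    2 ^ suc k ∸ 1                                          ∎
    where open ≡.≡-Reasoning

module Fermat {P : 𝔽₂[X].Poly} (P-irreducible : 𝔽₂X.Irreducible P) where

  open 𝔽₂[X]
  open IrreducibleOver𝔽₂ {P} P-irreducible
  open IntegerEmbedding.Solver polynomialRing using (solve; _:+_; _:-_; _:*_; _:=_; con)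
  open CommutativeRing polynomialRing using (*-isCommutativeMonoid)
  open SetoidPermutation ≋-setoid using (foldr-commMonoid)
  open ≡ using (refl; sym; trans; cong; cong₂; subst)

  -- A residue is represented by the remainder padded to length exactly n, so that
  -- congruent residues are equal lists.
  residue : Poly → Poly
  residue x = padTo n (Division.remainder (divideMonic (deg-bound P) P[n]≡true x))

  length-residue : ∀ x → length (residue x) ≡ n
  length-residue x = length-padTo n _

  ≈residue : ∀ x → x ≈ residue x mod P
  ≈residue x = ≈*+⇒≈mod {q = quotient} (begin
    x                                       ≈⟨ equation ⟩
    (P ⊛ quotient) ⊕ remainder              ≈⟨ ⊕-cong (⊛-comm quotient P) (padTo-≋ n remainder-bound) ⟨
    (quotient ⊛ P) ⊕ padTo n remainder      ∎)
    where
    open Division (divideMonic (deg-bound P) P[n]≡true x)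
    open ≋-Reasoning

  product : List Poly → Poly
  product = foldr _⊛_ one

  product-↭ : ∀ {us vs} → us ↭ vs → product us ≋ product vs
  product-↭ = foldr-commMonoid *-isCommutativeMonoid ∘ ↭⇒↭ₛ′ ≋-isEquivalence

  product-map-⊛ : ∀ a us → product (map (a ⊛_) us) ≋ (a ^ₚ length us) ⊛ product us
  product-map-⊛ a []       = ≋-sym (⊛-identityˡ one)
  product-map-⊛ a (u ∷ us) = begin
    (a ⊛ u) ⊛ product (map (a ⊛_) us)          ≈⟨ ⊛-congʳ (a ⊛ u) (product-map-⊛ a us) ⟩
    (a ⊛ u) ⊛ ((a ^ₚ length us) ⊛ product us)
      ≈⟨ solve 4 (λ a u aᵏ Π → (a :* u) :* (aᵏ :* Π) := (a :* aᵏ) :* (u :* Π))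
               ≋-refl a u (a ^ₚ length us) (product us) ⟩
    (a ⊛ (a ^ₚ length us)) ⊛ (u ⊛ product us)   ∎
    where open ≋-Reasoning

  product-mod : ∀ {f g : Poly → Poly} us → (∀ {u} → u ∈ us → f u ≈ g u mod P) →
                product (map f us) ≈ product (map g us) mod P
  product-mod []       _      = ≈⇒≈mod ≋-refl
  product-mod (u ∷ us) f≈g = mod-* (f≈g (here refl)) (product-mod us (f≈g ∘ there))

  P∤product : ∀ us → (∀ {u} → u ∈ us → ¬ P ∣ u) → ¬ P ∣ product us
  P∤product []       _     = P∤one
  P∤product (u ∷ us) P∤us P∣uΠ = P∤product us (P∤us ∘ there) (euclid (P∤us (here refl)) P∣uΠ)

  residues : List Poly
  residues = nonzeroBitStrings n

  residue-bound : ∀ {u} → u ∈ residues → DegreeBelow u n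
  residue-bound {u} u∈ = subst (DegreeBelow u) (proj₁ (nonzeroBitStrings-sound n u∈)) (DegreeBelow-length u)

  P∤residue : ∀ {u} → u ∈ residues → ¬ P ∣ u
  P∤residue u∈ P∣u = proj₂ (nonzeroBitStrings-sound n u∈) (∣-DegreeBelow⇒≋[] P∣u (residue-bound u∈))

  module _ {a : Poly} (P∤a : ¬ P ∣ a) where

    multiply : Poly → Poly
    multiply u = residue (a ⊛ u)

    multiply-∈ : ∀ {u} → u ∈ residues → multiply u ∈ residues
    multiply-∈ {u} u∈ = ∈-nonzeroBitStrings n (multiply u) (length-residue (a ⊛ u)) λ au≋[] →
      P∤residue u∈ (euclid P∤a (∣-resp-mod (mod-sym (≈residue (a ⊛ u)))
                                           (∣ʳ-respʳ-≈ (≋-sym au≋[]) (P ∣0))))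

    multiply-injective : ∀ {u v} → u ∈ residues → v ∈ residues → multiply u ≡ multiply v → u ≡ v
    multiply-injective {u} {v} u∈ v∈ au≡av = ≋∧length⇒≡ u≋v
      (trans (proj₁ (nonzeroBitStrings-sound n u∈)) (sym (proj₁ (nonzeroBitStrings-sound n v∈))))
      where
      au≈av : a ⊛ u ≈ a ⊛ v mod P
      au≈av = mod-trans (≈residue (a ⊛ u))
                        (subst (λ w → w ≈ a ⊛ v mod P) (sym au≡av) (mod-sym (≈residue (a ⊛ v))))
      P∣u-v : P ∣ u ⊖ v
      P∣u-v = euclid P∤a (∣ʳ-respʳ-≈ (solve 3 (λ a u v → a :* u :- a :* v := a :* (u :- v)) ≋-refl a u v)
                                  (m∣x-y au≈av))
      u≋v : u ≋ v
      u≋v = begin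
        u              ≈⟨ solve 2 (λ u v → u := (u :- v) :+ v) ≋-refl u v ⟩
        (u ⊖ v) ⊕ v    ≈⟨ ⊕-cong (∣-DegreeBelow⇒≋[] P∣u-v u-v<n) ≋-refl ⟩
        [] ⊕ v         ≈⟨ ⊕-identityˡ v ⟩
        v              ∎
        where
        open ≋-Reasoning
        u-v<n : DegreeBelow (u ⊖ v) n
        u-v<n = DegreeBelow-⊕ (residue-bound u∈) (DegreeBelow-neg (residue-bound v∈))

    multiply-↭ : map multiply residues ↭ residues
    multiply-↭ = unique-⊆-length⇒↭ (map multiply residues) residues
      (map-unique multiply multiply-injective (unique-nonzeroBitStrings n))
      (λ w∈ → case ∈-map⁻ multiply w∈ of λ { (u , u∈ , refl) → multiply-∈ u∈ })
      (ListP.length-map multiply residues)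

    -- Multiplication by a permutes the nonzero residues, so aᵏ Π ≡ Π for their product Π,
    -- which P does not divide.
    fermat : a ^ₚ (2 ^ n ∸ 1) ≈ one mod P
    fermat = subst (λ k → a ^ₚ k ≈ one mod P) (length-nonzeroBitStrings n)
      (divides-difference (euclid (P∤product residues P∤residue)
                                  (∣ʳ-respʳ-≈ Π⊛[aᵏ-1]≋ (m∣x-y aᵏΠ≈Π))))
      where
      k : ℕ
      k = length residues
      Π : Poly
      Π = product residues
      aᵏΠ≈Π : (a ^ₚ k) ⊛ Π ≈ Π mod P
      aᵏΠ≈Π = mod-trans (≈⇒≈mod (≋-sym (product-map-⊛ a residues)))
                (mod-trans (product-mod residues (λ {u} _ → ≈residue (a ⊛ u)))
                  (≈⇒≈mod (product-↭ multiply-↭)))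
      Π⊛[aᵏ-1]≋ : ((a ^ₚ k) ⊛ Π) ⊖ Π ≋ Π ⊛ ((a ^ₚ k) ⊖ one)
      Π⊛[aᵏ-1]≋ = solve 2 (λ aᵏ Π → aᵏ :* Π :- Π := Π :* (aᵏ :- con ℤ.1ℤ)) ≋-refl (a ^ₚ k) Π

lemma2 : ∀ {c ℓ} (K : CommutativeRing c ℓ) → InRing.IsFieldChar0 K
    → (ε : CommutativeRing.Carrier K) → InRing.IsUnit K ε
    → (F : ℤX.Poly) → InRing.IsMinPoly K F ε
    → (P : 𝔽₂X.Poly) (n : ℕ) → 𝔽₂X.Irreducible P → 𝔽₂X._∣ₚ_ P (φ F) → 𝔽₂X.deg P ≡ n
    → InRing.IsEven K (InRing.powK K ε (2 ^ n ∸ 1))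
lemma2 K (_ , _ , char-0) ε ε-unit F (F-monic , F-irreducible , Fε≈0)
       P .(𝔽₂X.deg P) P-irreducible P∣ₚφF ≡.refl G (_ , _ , Gεᵐ≈0) =
  Parity.natK≡false⇒even (L G) (≡.trans (Parity.natK-L G) (∣-constant⇒≡false P∣φG[1]))
  where
  open CommutativeRing K using (_≈_; 0#; trans)
  open InRing K using (eval)
  open Evaluation K
  open MinimalPolynomial K char-0 {ε} {F} F-monic F-irreducible Fε≈0 using (minimalPolynomial-∣)
  open 𝔽₂[X]
    using ( _∣_; X; _^ₚ_; compose; ∣ₚ⇒∣; ∣ʳ-trans; ∣ʳ-respʳ-≈; ∣-resp-mod
          ; compose-cong-mod; compose-one)
  open IrreducibleOver𝔽₂ {P} P-irreducible using (∣-constant⇒≡false; ∣-1∷⇒∤X)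
  open Fermat {P} P-irreducible using (fermat)

  m : ℕ
  m = 2 ^ 𝔽₂X.deg P ∸ 1

  P∣φ : ∀ R → eval R ε ≈ 0# → P ∣ φ R
  P∣φ R Rε≈0 = ∣ʳ-trans (∣ₚ⇒∣ P∣ₚφF) (ℤ[X]→𝔽₂[X].map-∣ (minimalPolynomial-∣ R Rε≈0))

  P∤X : ¬ P ∣ X
  P∤X with unit-annihilator ε-unit
  ... | r , [1∷r]ε≈0 = ∣-1∷⇒∤X (P∣φ (ℤ.1ℤ ∷ r) [1∷r]ε≈0)

  P∣φG∘Xᵐ : P ∣ compose (φ G) (X ^ₚ m)
  P∣φG∘Xᵐ = ≡.subst (P ∣_) φ[G∘Xᵐ]≡φG∘Xᵐ (P∣φ G∘Xᵐ G∘Xᵐ-root)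
    where
    G∘Xᵐ : ℤX.Poly
    G∘Xᵐ = ℤ[X].compose G (ℤ[X].X ℤ[X].^ₚ m)
    G∘Xᵐ-root : eval G∘Xᵐ ε ≈ 0#
    G∘Xᵐ-root = trans (eval-compose G _ ε) (trans (eval-arg G (eval-X^ₚ m ε)) Gεᵐ≈0)
    φ[G∘Xᵐ]≡φG∘Xᵐ : φ G∘Xᵐ ≡ compose (φ G) (X ^ₚ m)
    φ[G∘Xᵐ]≡φG∘Xᵐ = ≡.trans (ℤ[X]→𝔽₂[X].map-compose G _)
      (≡.cong (compose (φ G))
              (≡.trans (ℤ[X]→𝔽₂[X].map-^ₚ ℤ[X].X m) (≡.cong (_^ₚ m) ℤ[X]→𝔽₂[X].map-X)))

  P∣φG[1] : P ∣ (foldr _xor_ false (φ G) ∷ [])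
  P∣φG[1] = ∣ʳ-respʳ-≈ (compose-one (φ G)) (∣-resp-mod (compose-cong-mod (φ G) (fermat P∤X)) P∣φG∘Xᵐ)
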